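{- Let $\mathcal{P}_1$ be the set of partitions $\lambda=(\lambda_1,\ldots,\lambda_\ell)$ whose even-indexed parts $\lambda_2,\lambda_4,\ldots$ are all even. Then, as formal power series in $a,b,c,d$, $$\sum_{\lambda\in\mathcal{P}_{1}}\omega(\lambda)=\sum_{n=0}^{\infty}\frac{Q^{n}(-aQ^{ -1};Q)_{n}}{(ab;Q)_{n}(Q;Q)_{n}}+\sum_{n=0}^{\infty}\frac{abQ^{n}(-a;Q)_{n}}{(ab;Q)_{n+1}(Q;Q)_{n}}=\frac{(-a;Q)_{\infty}}{(ab;Q)_{\infty}(Q;Q)_{\infty}}.$$
   Context: A partition is a finite weakly decreasing sequence $\lambda=(\lambda_1,\ldots,\lambda_\ell)$ of positive integers (the empty partition is included); $\lambda_i=0$ for $i>\ell$. The four-parameter weight of $\lambda$ is $$\omega(\lambda)=a^{\sum_{i\ge1}\lceil\lambda_{2i-1}/2\rceil}\,b^{\sum_{i\ge1}\lfloor\lambda_{2i-1}/2\rfloor}\,c^{\sum_{i\ge1}\lceil\lambda_{2i}/2\rceil}\,d^{\sum_{i\ge1}\lfloor\lambda_{2i}/2\rfloor},$$ and $Q:=abcd$. $(x;q)_0=1$, $(x;q)_n=\prod_{i=0}^{n-1}(1-xq^i)$, $(x;q)_\infty=\prod_{i\ge0}(1-xq^i)$. -}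

module Defs where

open import Data.Nat as ℕ using (ℕ; zero; suc; _≤_; _<_; ⌊_/2⌋; ⌈_/2⌉; _≟_)
open import Data.Integer as ℤ using (ℤ; +_; -_)
open import Data.Bool using (Bool; true; false; if_then_else_; _∧_)
open import Data.Product using (_×_; _,_; ∃-syntax)
open import Data.Unit using (⊤)
open import Data.List using (List; []; _∷_; length)
open import Data.List.Relation.Unary.All using (All)
open import Data.List.Relation.Unary.Linked using (Linked)
open import Data.Nat.Divisibility using (_∣_)
open import Relation.Nullary.Decidable using (⌊_⌋)
open import Relation.Binary.PropositionalEquality using (_≡_)

IsPartition : List ℕ → Set
IsPartition λs = Linked ℕ._≥_ λs × All (0 ℕ.<_) λs

-- Exponent vectors (of a, b, c, d).
Exp : Set
Exp = ℕ × ℕ × ℕ × ℕ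

_+ᵉ_ : Exp → Exp → Exp
(p , q , r , s) +ᵉ (p' , q' , r' , s') = (p ℕ.+ p' , q ℕ.+ q' , r ℕ.+ r' , s ℕ.+ s')

weightExp : List ℕ → Exp
weightExp [] = (0 , 0 , 0 , 0)
weightExp (x ∷ []) = (⌈ x /2⌉ , ⌊ x /2⌋ , 0 , 0)
weightExp (x ∷ y ∷ r) = (⌈ x /2⌉ , ⌊ x /2⌋ , ⌈ y /2⌉ , ⌊ y /2⌋) +ᵉ weightExp r

EvenIndexedEven : List ℕ → Set
EvenIndexedEven [] = ⊤
EvenIndexedEven (x ∷ []) = ⊤
EvenIndexedEven (x ∷ y ∷ r) = (2 ∣ y) × EvenIndexedEven r

InP1 : List ℕ → Set
InP1 λs = IsPartition λs × EvenIndexedEven λs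

-- Formal power series in a, b, c, d with integer coefficients:
-- f i j k l = coefficient of a^i b^j c^k d^l.

FPS : Set
FPS = ℕ → ℕ → ℕ → ℕ → ℤ

Σ≤ : ℕ → (ℕ → ℤ) → ℤ
Σ≤ zero h = h 0
Σ≤ (suc n) h = Σ≤ n h ℤ.+ h (suc n)

zeroS : FPS
zeroS _ _ _ _ = + 0

_⊕_ : FPS → FPS → FPS
(f ⊕ g) i j k l = f i j k l ℤ.+ g i j k l

_⊛_ : FPS → FPS → FPS
(f ⊛ g) i j k l =
  Σ≤ i λ p → Σ≤ j λ q → Σ≤ k λ r → Σ≤ l λ s →
    f p q r s ℤ.* g (i ℕ.∸ p) (j ℕ.∸ q) (k ℕ.∸ r) (l ℕ.∸ s)

infixl 6 _⊕_
infixl 7 _⊛_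

mono : ℕ → ℕ → ℕ → ℕ → FPS
mono p q r s i j k l =
  if ⌊ p ≟ i ⌋ ∧ ⌊ q ≟ j ⌋ ∧ ⌊ r ≟ k ⌋ ∧ ⌊ s ≟ l ⌋ then + 1 else + 0

oneS : FPS
oneS = mono 0 0 0 0

Qpow : ℕ → FPS
Qpow t = mono t t t t

aQpow : ℕ → FPS
aQpow t = mono (suc t) t t t

abQpow : ℕ → FPS
abQpow t = mono (suc t) (suc t) t t

-- 1/(1 - a^p b^q c^r d^s) = Σ_{m≥0} a^{mp} b^{mq} c^{mr} d^{ms}.
-- For (p,q,r,s) ≠ 0 (the only case used), the terms with m > i+j+k+l
-- contribute nothing to the coefficient of a^i b^j c^k d^l, so the
-- sum below is exactly the coefficient of the geometric series.
geomInv : ℕ → ℕ → ℕ → ℕ → FPS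
geomInv p q r s i j k l =
  Σ≤ (i ℕ.+ j ℕ.+ k ℕ.+ l) λ m →
    mono (m ℕ.* p) (m ℕ.* q) (m ℕ.* r) (m ℕ.* s) i j k l

prodS : ℕ → (ℕ → FPS) → FPS
prodS zero f = oneS
prodS (suc n) f = prodS n f ⊛ f n

sumS : ℕ → (ℕ → FPS) → FPS
sumS zero f = zeroS
sumS (suc n) f = sumS n f ⊕ f n

negaQ : ℕ → FPS
negaQ n = prodS n λ t → oneS ⊕ aQpow t

invabQ : ℕ → FPS
invabQ n = prodS n λ t → geomInv (suc t) (suc t) t t

invQQ : ℕ → FPS
invQQ n = prodS n λ t → geomInv (suc t) (suc t) (suc t) (suc t)

-- Q^n (-aQ^{-1};Q)_n = Π_{t<n} Q (1 + aQ^{t-1}) = Π_{t<n} (Q + aQ^t)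
-- (Q^{-1} is not a power series, so one factor Q is absorbed into each
-- of the n factors).
QnNegaQinv : ℕ → FPS
QnNegaQinv n = prodS n λ t → Qpow 1 ⊕ aQpow t

term1 : ℕ → FPS
term1 n = QnNegaQinv n ⊛ invabQ n ⊛ invQQ n

term2 : ℕ → FPS
term2 n = abQpow n ⊛ negaQ n ⊛ invabQ (suc n) ⊛ invQQ n

rhsPartial : ℕ → FPS
rhsPartial N = negaQ N ⊛ invabQ N ⊛ invQQ N

-- Convergence of a sequence of coefficients in the (discrete) topology of
-- formal power series: eventually constant with value v.

Converges : (ℕ → ℤ) → ℤ → Set
Converges s v = ∃[ N₀ ] (∀ N → N₀ ≤ N → s N ≡ v)

module Submission where

-- Every series in the identity is a sum or product of geometric factors, so each coefficient
-- counts a class of combinatorial choices.  A partition in 𝒫₁ is cut into the blocks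
-- (λ_{2t+1}, λ_{2t+2}) and block t is recorded by the exponents (β, s, v) taken from the factors
-- 1 + aQ^t, 1/(1 - abQ^t) and 1/(1 - Q^{t+1}) of (-a;Q)_N / ((ab;Q)_N (Q;Q)_N): the block is
-- (2u + 2s + β, 2u) with u = v + ⌈λ_{2t+3}/2⌉.  This is a weight-preserving bijection onto the
-- partitions with at most 2N parts.  Constraining the last block identifies the n-th terms of
-- the two sums with the partitions of effective length 2n and 2n + 1 respectively.  A partition
-- of weight a^i b^j c^k d^l has at most i + k parts, so all three coefficient sequences are
-- eventually constant, equal to the number of such partitions.

module Counting where

  open import Defs
  open import Algebra.Bundles using (CommutativeMonoid)
  import Algebra.Solver.CommutativeMonoid
  open import Data.Empty using (⊥; ⊥-elim)
  open import Data.Integer as ℤ using (ℤ; +_)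
  import Data.Integer.Properties as ℤ
  open import Data.List as List using (List; []; _∷_; length; _++_; map; cartesianProduct)
  open import Data.List.Properties using (length-++; length-map)
  open import Data.List.Membership.Propositional using (_∈_)
  open import Data.List.Membership.Propositional.Properties
    using (++-∈⇔; map-∈↔; ∈-cartesianProduct⁺; ∈-cartesianProduct⁻)
  open import Data.List.Membership.Propositional.Properties.WithK using (unique∧set⇒bag)
  open import Data.List.Relation.Binary.BagAndSetEquality using (_∼[_]_; set; ∼bag⇒↭)
  open import Data.List.Relation.Binary.Permutation.Propositional.Properties using (↭-length)
  open import Data.List.Relation.Unary.All as All using (All; []; _∷_)
  import Data.List.Relation.Unary.All.Properties as All
  open import Data.List.Relation.Unary.Any using (here; there)
  open import Data.List.Relation.Unary.Linked as Linked using (Linked; []; [-]; _∷_)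
  open import Data.List.Relation.Unary.Unique.Propositional using (Unique; []; _∷_)
  import Data.List.Relation.Unary.Unique.Propositional.Properties as Unique
  open import Data.Nat as ℕ using (ℕ; zero; suc; _≤_; _<_; z≤n; s≤s; _∸_; ⌊_/2⌋; ⌈_/2⌉; _+_; _*_; _≟_)
  import Data.Nat.Properties as ℕ
  open import Data.Nat.Divisibility using (_∣_; divides)
  open import Data.Nat.Tactic.RingSolver using (solve-∀)
  open import Data.Product using (∃-syntax; _×_; _,_; proj₁; proj₂)
  open import Data.Product.Algebra using (×-distribʳ-⊎)
  open import Data.Product.Function.NonDependent.Propositional using (_×-⇔_)
  open import Data.Product.Properties using (×-≡,≡→≡; ×-≡,≡←≡)
  open import Data.Sum as Sum using (_⊎_; inj₁; inj₂; [_,_])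
  open import Data.Sum.Function.Propositional using (_⊎-⇔_)
  open import Data.Sum.Properties using (inj₁-injective; inj₂-injective)
  open import Data.Unit using (⊤; tt)
  open import Data.Vec using (Vec; []; _∷_; _∷ʳ_; initLast; zip; unzip)
  open import Data.Vec.Properties using (∷ʳ-injective; unzip∘zip; zip∘unzip)
  open import Function using (_∘_)
  open import Function.Bundles using (_⇔_; mk⇔; Equivalence)
  import Function.Properties.Equivalence as ⇔
  open import Function.Properties.Inverse using (↔⇒⇔)
  open import Relation.Binary.PropositionalEquality hiding ([_])
  open import Relation.Nullary using (¬_; yes; no)
  open import Algebra.Definitions (_≡_ {A = Exp}) using (Associative; Commutative; LeftIdentity; RightIdentity)

  private variable
    X Y : Set
    P Q : X → Set
    z z' : ℤ
    n : ℕ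

  record Enumeration {X : Set} (P : X → Set) (count : ℤ) : Set where
    field
      elements : List X
      unique   : Unique elements
      ∈⇔       : ∀ x → x ∈ elements ⇔ P x
      size     : + length elements ≡ count

  open Enumeration

  Enumeration-size-unique : Enumeration P z → Enumeration P z' → z ≡ z'
  Enumeration-size-unique e e' =
    trans (sym (size e)) (trans (cong +_ (↭-length (∼bag⇒↭ (unique∧set⇒bag (unique e) (unique e') same)))) (size e'))
    where
    same : elements e ∼[ set ] elements e'
    same {x} = ⇔.trans (∈⇔ e x) (⇔.sym (∈⇔ e' x))

  Enumeration-⇔ : (∀ x → P x ⇔ Q x) → Enumeration P z → Enumeration Q z
  Enumeration-⇔ P⇔Q e = record
    { elements = elements e ; unique = unique e ; ∈⇔ = λ x → ⇔.trans (∈⇔ e x) (P⇔Q x) ; size = size e }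

  Enumeration-∅ : (∀ x → ¬ P x) → Enumeration P (+ 0)
  Enumeration-∅ ¬P = record
    { elements = [] ; unique = [] ; ∈⇔ = λ x → mk⇔ (λ ()) (⊥-elim ∘ ¬P x) ; size = refl }

  Enumeration-singleton : (a : X) → (∀ x → x ≡ a ⇔ P x) → Enumeration P (+ 1)
  Enumeration-singleton a ≡a⇔P = record
    { elements = List.[ a ] ; unique = [] ∷ []
    ; ∈⇔ = λ x → ⇔.trans (mk⇔ (λ { (here x≡a) → x≡a ; (there ()) }) here) (≡a⇔P x) ; size = refl }

  Enumeration-∪ : (∀ x → P x → Q x → ⊥) → Enumeration P z → Enumeration Q z' →
                  Enumeration (λ x → P x ⊎ Q x) (z ℤ.+ z')
  Enumeration-∪ disjoint e e' = record
    { elements = elements e ++ elements e'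
    ; unique   = Unique.++⁺ (unique e) (unique e')
                   λ { {x} (x∈e , x∈e') → disjoint x (Equivalence.to (∈⇔ e x) x∈e) (Equivalence.to (∈⇔ e' x) x∈e') }
    ; ∈⇔       = λ x → ⇔.trans ++-∈⇔ (∈⇔ e x ⊎-⇔ ∈⇔ e' x)
    ; size     = trans (cong +_ (length-++ (elements e)))
                       (trans (ℤ.pos-+ (length (elements e)) _) (cong₂ ℤ._+_ (size e) (size e')))
    }

  length-cartesianProduct : (xs : List X) (ys : List Y) →
                            length (cartesianProduct xs ys) ≡ length xs ℕ.* length ys
  length-cartesianProduct []       ys = refl
  length-cartesianProduct (x ∷ xs) ys =
    trans (length-++ (map (x ,_) ys)) (cong₂ ℕ._+_ (length-map (x ,_) ys) (length-cartesianProduct xs ys))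

  Enumeration-× : Enumeration P z → Enumeration Q z' → Enumeration (λ (x , y) → P x × Q y) (z ℤ.* z')
  Enumeration-× e e' = record
    { elements = cartesianProduct (elements e) (elements e')
    ; unique   = Unique.cartesianProduct⁺ (unique e) (unique e')
    ; ∈⇔       = λ (x , y) → ⇔.trans (mk⇔ (∈-cartesianProduct⁻ _ _) λ (p , q) → ∈-cartesianProduct⁺ p q)
                                     (∈⇔ e x ×-⇔ ∈⇔ e' y)
    ; size     = trans (cong +_ (length-cartesianProduct (elements e) (elements e')))
                       (trans (ℤ.pos-* (length (elements e)) _) (cong₂ ℤ._*_ (size e) (size e')))
    }

  module _ (f : X → Y) (injective : ∀ {x x'} → P x → P x' → f x ≡ f x' → x ≡ x') where

    unique-map : ∀ {xs} → All P xs → Unique xs → Unique (map f xs)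
    unique-map []         []         = []
    unique-map (px ∷ pxs) (x∉ ∷ xs!) =
      All.map⁺ (All.zipWith (λ (py , x≢y) fx≡fy → x≢y (injective px py fx≡fy)) (pxs , x∉)) ∷ unique-map pxs xs!

    Enumeration-map : (∀ y → (∃[ x ] (P x × y ≡ f x)) ⇔ Q y) → Enumeration P z → Enumeration Q z
    Enumeration-map image⇔Q e = record
      { elements = map f (elements e)
      ; unique   = unique-map (All.tabulate λ {x} x∈ → Equivalence.to (∈⇔ e x) x∈) (unique e)
      ; ∈⇔       = λ y → ⇔.trans (⇔.sym (↔⇒⇔ (map-∈↔ f)))
                           (⇔.trans (mk⇔ (λ (x , x∈ , y≡) → x , Equivalence.to (∈⇔ e x) x∈ , y≡)
                                         (λ (x , px , y≡) → x , Equivalence.from (∈⇔ e x) px , y≡))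
                                    (image⇔Q y))
      ; size     = trans (cong +_ (length-map f (elements e))) (size e)
      }

  Enumeration-⊎ : Enumeration P z → Enumeration Q z' → Enumeration [ P , Q ] (z ℤ.+ z')
  Enumeration-⊎ {P = P} {Q = Q} e e' =
    Enumeration-⇔ sides
      (Enumeration-∪ (λ { _ (x , _ , refl) (y , _ , ()) })
        (Enumeration-map inj₁ (λ _ _ → inj₁-injective) (λ _ → ⇔.refl) e)
        (Enumeration-map inj₂ (λ _ _ → inj₂-injective) (λ _ → ⇔.refl) e'))
    where
    sides : ∀ z → ((∃[ x ] (P x × z ≡ inj₁ x)) ⊎ (∃[ y ] (Q y × z ≡ inj₂ y))) ⇔ [ P , Q ] z
    sides (inj₁ x) = mk⇔ (λ { (inj₁ (_ , px , refl)) → px }) (λ px → inj₁ (x , px , refl))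
    sides (inj₂ y) = mk⇔ (λ { (inj₂ (_ , qy , refl)) → qy }) (λ qy → inj₂ (y , qy , refl))

  ∃≤-suc⇔ : {F : ℕ → Set} {n : ℕ} → ((∃[ t ] (t ≤ n × F t)) ⊎ F (suc n)) ⇔ (∃[ t ] (t ≤ suc n × F t))
  ∃≤-suc⇔ {F} {n} = mk⇔ to from
    where
    to : (∃[ t ] (t ≤ n × F t)) ⊎ F (suc n) → ∃[ t ] (t ≤ suc n × F t)
    to (inj₁ (t , t≤n , ft)) = t , ℕ.m≤n⇒m≤1+n t≤n , ft
    to (inj₂ fn)             = suc n , ℕ.≤-refl , fn
    from : ∃[ t ] (t ≤ suc n × F t) → (∃[ t ] (t ≤ n × F t)) ⊎ F (suc n)
    from (t , t≤1+n , ft) with ℕ.m≤n⇒m<n∨m≡n t≤1+n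
    ... | inj₁ (s≤s t≤n) = inj₁ (t , t≤n , ft)
    ... | inj₂ refl      = inj₂ ft

  ∃<-suc⇔ : {F : ℕ → Set} {n : ℕ} → ((∃[ t ] (t < n × F t)) ⊎ F n) ⇔ (∃[ t ] (t < suc n × F t))
  ∃<-suc⇔ {F} {n} = mk⇔ to from
    where
    to : (∃[ t ] (t < n × F t)) ⊎ F n → ∃[ t ] (t < suc n × F t)
    to (inj₁ (t , t<n , ft)) = t , ℕ.m≤n⇒m≤1+n t<n , ft
    to (inj₂ fn)             = n , ℕ.≤-refl , fn
    from : ∃[ t ] (t < suc n × F t) → (∃[ t ] (t < n × F t)) ⊎ F n
    from (t , s≤s t≤n , ft) with ℕ.m≤n⇒m<n∨m≡n t≤n
    ... | inj₁ t<n  = inj₁ (t , t<n , ft)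
    ... | inj₂ refl = inj₂ ft

  DisjointFamily : (ℕ → X → Set) → Set
  DisjointFamily F = ∀ {t t' x} → F t x → F t' x → t ≡ t'

  Enumeration-Σ≤ : {F : ℕ → X → Set} (h : ℕ → ℤ) (n : ℕ) → DisjointFamily F →
                   (∀ t → t ≤ n → Enumeration (F t) (h t)) →
                   Enumeration (λ x → ∃[ t ] (t ≤ n × F t x)) (Σ≤ n h)
  Enumeration-Σ≤ h zero    disjoint e =
    Enumeration-⇔ (λ _ → mk⇔ (λ ft → 0 , z≤n , ft) λ { (0 , _ , ft) → ft }) (e 0 z≤n)
  Enumeration-Σ≤ h (suc n) disjoint e =
    Enumeration-⇔ (λ _ → ∃≤-suc⇔)
      (Enumeration-∪ (λ { _ (t , t≤n , ft) fn → ℕ.<-irrefl (disjoint ft fn) (s≤s t≤n) })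
        (Enumeration-Σ≤ h n disjoint (λ t t≤n → e t (ℕ.m≤n⇒m≤1+n t≤n)))
        (e (suc n) ℕ.≤-refl))

  0ᵉ : Exp
  0ᵉ = 0 , 0 , 0 , 0

  Exp-≡ : ∀ {p q r s p' q' r' s' : ℕ} → p ≡ p' → q ≡ q' → r ≡ r' → s ≡ s' →
          _≡_ {A = Exp} (p , q , r , s) (p' , q' , r' , s')
  Exp-≡ refl refl refl refl = refl

  +ᵉ-assoc : Associative _+ᵉ_
  +ᵉ-assoc (p , q , r , s) (p' , q' , r' , s') (p'' , q'' , r'' , s'') =
    Exp-≡ (ℕ.+-assoc p p' p'') (ℕ.+-assoc q q' q'') (ℕ.+-assoc r r' r'') (ℕ.+-assoc s s' s'')

  +ᵉ-comm : Commutative _+ᵉ_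
  +ᵉ-comm (p , q , r , s) (p' , q' , r' , s') = Exp-≡ (ℕ.+-comm p p') (ℕ.+-comm q q') (ℕ.+-comm r r') (ℕ.+-comm s s')

  +ᵉ-identityˡ : LeftIdentity 0ᵉ _+ᵉ_
  +ᵉ-identityˡ _ = refl

  +ᵉ-identityʳ : RightIdentity 0ᵉ _+ᵉ_
  +ᵉ-identityʳ (p , q , r , s) = Exp-≡ (ℕ.+-identityʳ p) (ℕ.+-identityʳ q) (ℕ.+-identityʳ r) (ℕ.+-identityʳ s)

  +ᵉ-0ᵉ-commutativeMonoid : CommutativeMonoid _ _
  +ᵉ-0ᵉ-commutativeMonoid = record
    { Carrier = Exp ; _≈_ = _≡_ ; _∙_ = _+ᵉ_ ; ε = 0ᵉ
    ; isCommutativeMonoid = record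
      { isMonoid = record
        { isSemigroup = record
          { isMagma = record { isEquivalence = isEquivalence ; ∙-cong = cong₂ _+ᵉ_ } ; assoc = +ᵉ-assoc }
        ; identity = +ᵉ-identityˡ , +ᵉ-identityʳ }
      ; comm = +ᵉ-comm } }

  module +ᵉ-Solver = Algebra.Solver.CommutativeMonoid +ᵉ-0ᵉ-commutativeMonoid
    renaming (_⊕_ to _⊞_)

  +ᵉ-interchange : ∀ a b c d → (a +ᵉ b) +ᵉ (c +ᵉ d) ≡ (a +ᵉ c) +ᵉ (b +ᵉ d)
  +ᵉ-interchange = solve 4 (λ a b c d → (a ⊞ b) ⊞ (c ⊞ d) ⊜ (a ⊞ c) ⊞ (b ⊞ d)) refl
    where open +ᵉ-Solver

  Generates : {X : Set} → FPS → (X → Set) → (X → Exp) → Set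
  Generates f P w = ∀ i j k l → Enumeration (λ x → P x × w x ≡ (i , j , k , l)) (f i j k l)

  record WeightedBijection {X Y : Set} (P : X → Set) (w : X → Exp) (Q : Y → Set) (w' : Y → Exp) : Set where
    field
      to         : X → Y
      injective  : ∀ {x x'} → P x → P x' → to x ≡ to x' → x ≡ x'
      to-∈       : ∀ {x} → P x → Q (to x)
      weight     : ∀ {x} → P x → w' (to x) ≡ w x
      surjective : ∀ {y} → Q y → ∃[ x ] (P x × y ≡ to x)

  Generates-bijection : ∀ {f} {w : X → Exp} {w' : Y → Exp} →
                        WeightedBijection P w Q w' → Generates f P w → Generates f Q w'
  Generates-bijection {P = P} {Q = Q} {w = w} {w' = w'} φ gf i j k l =
    Enumeration-map to (λ (px , _) (px' , _) → injective px px') image (gf i j k l)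
    where
    open WeightedBijection φ
    image : ∀ y → (∃[ x ] ((P x × w x ≡ (i , j , k , l)) × y ≡ to x)) ⇔ (Q y × w' y ≡ (i , j , k , l))
    image y = mk⇔ (λ { (x , (px , wx≡) , refl) → to-∈ px , trans (weight px) wx≡ })
                   (λ (qy , w'y≡) → let (x , px , y≡) = surjective qy in
                      x , (px , trans (sym (weight px)) (trans (cong w' (sym y≡)) w'y≡)) , y≡)

  Generates-⇔ : ∀ {f} {w : X → Exp} → (∀ x → P x ⇔ Q x) → Generates f P w → Generates f Q w
  Generates-⇔ P⇔Q gf i j k l = Enumeration-⇔ (λ x → P⇔Q x ×-⇔ ⇔.refl) (gf i j k l)

  expA expB expC expD : Exp → ℕ
  expA (p , _ , _ , _) = p
  expB (_ , q , _ , _) = q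
  expC (_ , _ , r , _) = r
  expD (_ , _ , _ , s) = s

  mono-generates : ∀ p q r s → Generates (mono p q r s) (λ (_ : ⊤) → ⊤) (λ _ → (p , q , r , s))
  mono-generates p q r s i j k l with p ≟ i | q ≟ j | r ≟ k | s ≟ l
  ... | yes refl | yes refl | yes refl | yes refl = Enumeration-singleton tt (λ _ → mk⇔ (λ _ → tt , refl) (λ _ → refl))
  ... | no p≢i | _        | _        | _        = Enumeration-∅ (λ _ (_ , e) → p≢i (cong expA e))
  ... | yes _  | no q≢j   | _        | _        = Enumeration-∅ (λ _ (_ , e) → q≢j (cong expB e))
  ... | yes _  | yes _    | no r≢k   | _        = Enumeration-∅ (λ _ (_ , e) → r≢k (cong expC e))
  ... | yes _  | yes _    | yes _    | no s≢l   = Enumeration-∅ (λ _ (_ , e) → s≢l (cong expD e))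

  ⊕-generates : ∀ {f g} {w : X → Exp} {w' : Y → Exp} →
                Generates f P w → Generates g Q w' → Generates (f ⊕ g) [ P , Q ] [ w , w' ]
  ⊕-generates gf gg i j k l =
    Enumeration-⇔ (λ { (inj₁ _) → ⇔.refl ; (inj₂ _) → ⇔.refl }) (Enumeration-⊎ (gf i j k l) (gg i j k l))

  +ᵉ-fibre : ∀ {u v : Exp} {i j k l} → u +ᵉ v ≡ (i , j , k , l) ⇔
             (∃[ p ] (p ≤ i × ∃[ q ] (q ≤ j × ∃[ r ] (r ≤ k × ∃[ s ] (s ≤ l ×
               u ≡ (p , q , r , s) × v ≡ (i ∸ p , j ∸ q , k ∸ r , l ∸ s))))))
  +ᵉ-fibre {u = p , q , r , s} {v = p' , q' , r' , s'} = mk⇔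
    (λ { refl → p , ℕ.m≤m+n p p' , q , ℕ.m≤m+n q q' , r , ℕ.m≤m+n r r' , s , ℕ.m≤m+n s s' , refl ,
                sym (Exp-≡ (ℕ.m+n∸m≡n p p') (ℕ.m+n∸m≡n q q') (ℕ.m+n∸m≡n r r') (ℕ.m+n∸m≡n s s')) })
    (λ { (_ , p≤i , _ , q≤j , _ , r≤k , _ , s≤l , refl , refl) →
           Exp-≡ (ℕ.m+[n∸m]≡n p≤i) (ℕ.m+[n∸m]≡n q≤j) (ℕ.m+[n∸m]≡n r≤k) (ℕ.m+[n∸m]≡n s≤l) })

  ⊛-generates : ∀ {f g} {w : X → Exp} {w' : Y → Exp} → Generates f P w → Generates g Q w' →
                Generates (f ⊛ g) (λ (x , y) → P x × Q y) (λ (x , y) → w x +ᵉ w' y)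
  ⊛-generates {P = P} {Q = Q} {w = w} {w' = w'} gf gg i j k l =
    Enumeration-⇔ (λ _ → regroup)
      (Enumeration-Σ≤ _ i (λ (_ , _ , _ , _ , _ , _ , (_ , e) , _) (_ , _ , _ , _ , _ , _ , (_ , e') , _) →
                             cong expA (trans (sym e) e')) λ p _ →
       Enumeration-Σ≤ _ j (λ (_ , _ , _ , _ , (_ , e) , _) (_ , _ , _ , _ , (_ , e') , _) →
                             cong expB (trans (sym e) e')) λ q _ →
       Enumeration-Σ≤ _ k (λ (_ , _ , (_ , e) , _) (_ , _ , (_ , e') , _) → cong expC (trans (sym e) e')) λ r _ →
       Enumeration-Σ≤ _ l (λ ((_ , e) , _) ((_ , e') , _) → cong expD (trans (sym e) e')) λ s _ →
       Enumeration-× (gf p q r s) (gg (i ∸ p) (j ∸ q) (k ∸ r) (l ∸ s)))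
    where
    regroup : ∀ {x y} →
      (∃[ p ] (p ≤ i × ∃[ q ] (q ≤ j × ∃[ r ] (r ≤ k × ∃[ s ] (s ≤ l ×
        (P x × w x ≡ (p , q , r , s)) × (Q y × w' y ≡ (i ∸ p , j ∸ q , k ∸ r , l ∸ s)))))))
      ⇔ ((P x × Q y) × w x +ᵉ w' y ≡ (i , j , k , l))
    regroup = mk⇔
      (λ (p , p≤i , q , q≤j , r , r≤k , s , s≤l , (px , wx≡) , (qy , w'y≡)) →
         (px , qy) , Equivalence.from +ᵉ-fibre (p , p≤i , q , q≤j , r , r≤k , s , s≤l , wx≡ , w'y≡))
      (λ ((px , qy) , w≡) →
         let (p , p≤i , q , q≤j , r , r≤k , s , s≤l , wx≡ , w'y≡) = Equivalence.to +ᵉ-fibre w≡ in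
         p , p≤i , q , q≤j , r , r≤k , s , s≤l , (px , wx≡) , (qy , w'y≡))

  geomInv-generates : ∀ p q r s →
    Generates (geomInv (suc p) q r s) (λ (_ : ℕ) → ⊤) (λ m → (m * suc p , m * q , m * r , m * s))
  geomInv-generates p q r s i j k l =
    Enumeration-⇔ (λ _ → bounded)
      (Enumeration-Σ≤ _ (i + j + k + l) (λ (_ , _ , e) (_ , _ , e') → trans (sym e) e') λ t _ →
         Enumeration-map (λ _ → t) (λ _ _ _ → refl) (λ _ → ⇔.refl)
           (mono-generates (t * suc p) (t * q) (t * r) (t * s) i j k l))
    where
    weight : ℕ → Exp
    weight m = m * suc p , m * q , m * r , m * s
    bounded : ∀ {m} → (∃[ t ] (t ≤ i + j + k + l × ∃[ _ ] ((⊤ × weight t ≡ (i , j , k , l)) × m ≡ t)))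
                      ⇔ (⊤ × weight m ≡ (i , j , k , l))
    bounded {m} = mk⇔ (λ { (_ , _ , _ , w≡ , refl) → w≡ })
      (λ (_ , w≡) → m , m≤ (cong expA w≡) , tt , (tt , w≡) , refl)
      where
      m≤ : m * suc p ≡ i → m ≤ i + j + k + l
      m≤ refl = ℕ.≤-trans (ℕ.m≤m*n m (suc p))
                          (ℕ.≤-trans (ℕ.m≤m+n _ j) (ℕ.≤-trans (ℕ.m≤m+n _ k) (ℕ.m≤m+n _ l)))

  indexedWeight : ∀ {n} → (ℕ → X → Exp) → ℕ → Vec X n → Exp
  indexedWeight w o []       = 0ᵉ
  indexedWeight w o (x ∷ xs) = w o x +ᵉ indexedWeight w (suc o) xs

  indexedWeight-∷ʳ : ∀ {n} (w : ℕ → X → Exp) o (xs : Vec X n) x →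
                     indexedWeight w o (xs ∷ʳ x) ≡ indexedWeight w o xs +ᵉ w (o + n) x
  indexedWeight-∷ʳ w o []       x = trans (+ᵉ-identityʳ (w o x)) (cong (λ t → w t x) (sym (ℕ.+-identityʳ o)))
  indexedWeight-∷ʳ {n = suc n} w o (y ∷ xs) x = begin
    w o y +ᵉ indexedWeight w (suc o) (xs ∷ʳ x)               ≡⟨ cong (w o y +ᵉ_) (indexedWeight-∷ʳ w (suc o) xs x) ⟩
    w o y +ᵉ (W +ᵉ w (suc o + n) x)                          ≡⟨ sym (+ᵉ-assoc (w o y) W _) ⟩
    (w o y +ᵉ W) +ᵉ w (suc o + n) x                          ≡⟨ cong (λ t → (w o y +ᵉ W) +ᵉ w t x) (sym (ℕ.+-suc o n)) ⟩
    (w o y +ᵉ W) +ᵉ w (o + suc n) x                          ∎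
    where
    open ≡-Reasoning
    W = indexedWeight w (suc o) xs

  indexedWeight-zip : ∀ {n} (w : ℕ → X → Exp) (w' : ℕ → Y → Exp) o (xs : Vec X n) (ys : Vec Y n) →
                      indexedWeight (λ t (x , y) → w t x +ᵉ w' t y) o (zip xs ys)
                      ≡ indexedWeight w o xs +ᵉ indexedWeight w' o ys
  indexedWeight-zip w w' o []       []       = refl
  indexedWeight-zip w w' o (x ∷ xs) (y ∷ ys) =
    trans (cong ((w o x +ᵉ w' o y) +ᵉ_) (indexedWeight-zip w w' (suc o) xs ys))
          (+ᵉ-interchange (w o x) (w' o y) (indexedWeight w (suc o) xs) (indexedWeight w' (suc o) ys))

  prodS-generates : ∀ {f : ℕ → FPS} {w : ℕ → X → Exp} → (∀ t → Generates (f t) (λ _ → ⊤) (w t)) →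
                    ∀ n → Generates (prodS n f) (λ (_ : Vec X n) → ⊤) (indexedWeight w 0)
  prodS-generates {X = X} {w = w} gf zero = Generates-bijection empty (mono-generates 0 0 0 0)
    where
    empty : WeightedBijection (λ _ → ⊤) (λ _ → 0ᵉ) (λ (_ : Vec X 0) → ⊤) (indexedWeight w 0)
    empty = record { to = λ _ → [] ; injective = λ _ _ _ → refl ; to-∈ = λ _ → tt ; weight = λ _ → refl
                   ; surjective = λ { {[]} _ → tt , tt , refl } }
  prodS-generates {X = X} {w = w} gf (suc n) = Generates-bijection snoc (⊛-generates (prodS-generates gf n) (gf n))
    where
    snoc : WeightedBijection (λ _ → ⊤ × ⊤) (λ (xs , x) → indexedWeight w 0 xs +ᵉ w n x)
                             (λ (_ : Vec X (suc n)) → ⊤) (indexedWeight w 0)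
    snoc = record
      { to         = λ (xs , x) → xs ∷ʳ x
      ; injective  = λ { {xs , x} {ys , y} _ _ eq → let (xs≡ys , x≡y) = ∷ʳ-injective xs ys eq in cong₂ _,_ xs≡ys x≡y }
      ; to-∈       = λ _ → tt
      ; weight     = λ { {xs , x} _ → indexedWeight-∷ʳ w 0 xs x }
      ; surjective = λ { {ys} _ → let (xs , x , ys≡) = initLast ys in (xs , x) , (tt , tt) , ys≡ }
      }

  zip-injective : ∀ {n} {xs xs' : Vec X n} {ys ys' : Vec Y n} → zip xs ys ≡ zip xs' ys' → xs ≡ xs' × ys ≡ ys'
  zip-injective {xs = xs} {xs'} {ys} {ys'} eq =
    ×-≡,≡←≡ (trans (sym (unzip∘zip xs ys)) (trans (cong unzip eq) (unzip∘zip xs' ys')))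

  ⊛-zip-generates : ∀ {n f g} {w : ℕ → X → Exp} {w' : ℕ → Y → Exp} →
                    Generates f (λ (_ : Vec X n) → ⊤) (indexedWeight w 0) →
                    Generates g (λ (_ : Vec Y n) → ⊤) (indexedWeight w' 0) →
                    Generates (f ⊛ g) (λ (_ : Vec (X × Y) n) → ⊤) (indexedWeight (λ t (x , y) → w t x +ᵉ w' t y) 0)
  ⊛-zip-generates {X = X} {Y = Y} {n = n} {w = w} {w' = w'} gf gg = Generates-bijection zipping (⊛-generates gf gg)
    where
    zipping : WeightedBijection (λ _ → ⊤ × ⊤) (λ (xs , ys) → indexedWeight w 0 xs +ᵉ indexedWeight w' 0 ys)
                                (λ (_ : Vec (X × Y) n) → ⊤) (indexedWeight (λ t (x , y) → w t x +ᵉ w' t y) 0)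
    zipping = record
      { to         = λ (xs , ys) → zip xs ys
      ; injective  = λ _ _ eq → ×-≡,≡→≡ (zip-injective eq)
      ; to-∈       = λ _ → tt
      ; weight     = λ { {xs , ys} _ → indexedWeight-zip w w' 0 xs ys }
      ; surjective = λ { {xys} _ → unzip xys , (tt , tt) , sym (zip∘unzip xys) }
      }

  sumS-generates : ∀ {f : ℕ → FPS} {P : ℕ → X → Set} {w : X → Exp} →
                   (∀ n → Generates (f n) (P n) w) → DisjointFamily P →
                   ∀ N → Generates (sumS N f) (λ x → ∃[ n ] (n < N × P n x)) w
  sumS-generates gf disjoint zero    i j k l = Enumeration-∅ λ { _ ((_ , () , _) , _) }
  sumS-generates gf disjoint (suc N) i j k l =
    Enumeration-⇔ (λ _ → ⇔.trans (⇔.sym (↔⇒⇔ (×-distribʳ-⊎ _ _ _ _))) (∃<-suc⇔ ×-⇔ ⇔.refl))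
      (Enumeration-∪ (λ { _ ((_ , n<N , pn) , _) (pN , _) → ℕ.<-irrefl (disjoint pn pN) n<N })
        (sumS-generates gf disjoint N i j k l) (gf N i j k l))

  Bit : Set
  Bit = ⊤ ⊎ ⊤

  pattern bit0 = inj₁ tt
  pattern bit1 = inj₂ tt

  bit : Bit → ℕ
  bit bit0 = 0
  bit bit1 = 1

  parity : ℕ → Bit
  parity zero          = bit0
  parity (suc zero)    = bit1
  parity (suc (suc n)) = parity n

  ⌊m+m+β/2⌋≡m : ∀ m β → ⌊ m + m + bit β /2⌋ ≡ m
  ⌊m+m+β/2⌋≡m zero    bit0 = refl
  ⌊m+m+β/2⌋≡m zero    bit1 = refl
  ⌊m+m+β/2⌋≡m (suc m) β rewrite ℕ.+-suc m m = cong suc (⌊m+m+β/2⌋≡m m β)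

  ⌈m+m+β/2⌉≡m+β : ∀ m β → ⌈ m + m + bit β /2⌉ ≡ m + bit β
  ⌈m+m+β/2⌉≡m+β zero    bit0 = refl
  ⌈m+m+β/2⌉≡m+β zero    bit1 = refl
  ⌈m+m+β/2⌉≡m+β (suc m) β rewrite ℕ.+-suc m m = cong suc (⌈m+m+β/2⌉≡m+β m β)

  parity-m+m+β : ∀ m β → parity (m + m + bit β) ≡ β
  parity-m+m+β zero    bit0 = refl
  parity-m+m+β zero    bit1 = refl
  parity-m+m+β (suc m) β rewrite ℕ.+-suc m m = parity-m+m+β m β

  ⌊n/2⌋+⌊n/2⌋+parity≡n : ∀ n → ⌊ n /2⌋ + ⌊ n /2⌋ + bit (parity n) ≡ n
  ⌊n/2⌋+⌊n/2⌋+parity≡n zero          = refl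
  ⌊n/2⌋+⌊n/2⌋+parity≡n (suc zero)    = refl
  ⌊n/2⌋+⌊n/2⌋+parity≡n (suc (suc n)) rewrite ℕ.+-suc ⌊ n /2⌋ ⌊ n /2⌋ = cong (suc ∘ suc) (⌊n/2⌋+⌊n/2⌋+parity≡n n)

  double-injective : ∀ {n n'} → n + n ≡ n' + n' → n ≡ n'
  double-injective {n} {n'} eq = trans (ℕ.n≡⌊n+n/2⌋ n) (trans (cong ⌊_/2⌋ eq) (sym (ℕ.n≡⌊n+n/2⌋ n')))

  even⊎odd : ∀ x → (∃[ n ] (x ≡ n + n)) ⊎ (∃[ n ] (x ≡ suc (n + n)))
  even⊎odd x with parity x | ⌊n/2⌋+⌊n/2⌋+parity≡n x
  ... | bit0 | eq = inj₁ (⌊ x /2⌋ , trans (sym eq) (ℕ.+-identityʳ _))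
  ... | bit1 | eq = inj₂ (⌊ x /2⌋ , trans (sym eq) (ℕ.+-comm _ 1))

  even≢odd : ∀ n n' → n + n ≢ suc (n' + n')
  even≢odd n n' eq = bit0≢bit1 (trans (sym (parity-m+m+β n bit0)) (trans (cong parity n+n+0≡n'+n'+1) (parity-m+m+β n' bit1)))
    where
    bit0≢bit1 : bit0 ≢ bit1
    bit0≢bit1 ()
    n+n+0≡n'+n'+1 : n + n + 0 ≡ n' + n' + 1
    n+n+0≡n'+n'+1 = trans (ℕ.+-identityʳ (n + n)) (trans eq (ℕ.+-comm 1 (n' + n')))

  largestPart : List ℕ → ℕ
  largestPart []      = 0
  largestPart (x ∷ _) = x

  Positive : List ℕ → Set
  Positive = All (0 <_)

  -- Parts equal to 0 are dropped; whenever that happens below, the tail is empty anyway.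
  prependPair : ℕ → ℕ → List ℕ → List ℕ
  prependPair zero    _       _ = []
  prependPair (suc x) zero    _ = suc x ∷ []
  prependPair (suc x) (suc y) r = suc x ∷ suc y ∷ r

  splitPair : List ℕ → ℕ × ℕ × List ℕ
  splitPair []          = 0 , 0 , []
  splitPair (x ∷ [])    = x , 0 , []
  splitPair (x ∷ y ∷ r) = x , y , r

  splitPair-prependPair : ∀ {x y r} → y ≤ x → (y ≡ 0 → r ≡ []) → splitPair (prependPair x y r) ≡ (x , y , r)
  splitPair-prependPair {zero}  {zero}  z≤n r≡[] rewrite r≡[] refl = refl
  splitPair-prependPair {suc x} {zero}  _   r≡[] rewrite r≡[] refl = refl
  splitPair-prependPair {suc x} {suc y} _   _    = refl

  largestPart-prependPair : ∀ x y r → largestPart (prependPair x y r) ≡ x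
  largestPart-prependPair zero    _       _ = refl
  largestPart-prependPair (suc x) zero    _ = refl
  largestPart-prependPair (suc x) (suc y) _ = refl

  prependPair-positive : ∀ x y {r} → Positive r → Positive (prependPair x y r)
  prependPair-positive zero    _       _   = []
  prependPair-positive (suc x) zero    _   = s≤s z≤n ∷ []
  prependPair-positive (suc x) (suc y) pos = s≤s z≤n ∷ s≤s z≤n ∷ pos

  prependPair-evenIndexedEven : ∀ x y {r} → 2 ∣ y → EvenIndexedEven r → EvenIndexedEven (prependPair x y r)
  prependPair-evenIndexedEven zero    _       _   _  = tt
  prependPair-evenIndexedEven (suc x) zero    _   _  = tt
  prependPair-evenIndexedEven (suc x) (suc y) 2∣y ev = 2∣y , ev

  prependPair-linked : ∀ {x y r} → y ≤ x → largestPart r ≤ y → Linked ℕ._≥_ r → Linked ℕ._≥_ (prependPair x y r)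
  prependPair-linked {zero}              _   _   _   = []
  prependPair-linked {suc x} {zero}      _   _   _   = [-]
  prependPair-linked {suc x} {suc y} {[]}    y≤x _   _   = y≤x ∷ [-]
  prependPair-linked {suc x} {suc y} {_ ∷ _} y≤x r≤y lnk = y≤x ∷ r≤y ∷ lnk

  prependPair-length : ∀ x y r → length (prependPair x y r) ≤ 2 + length r
  prependPair-length zero    _       _ = z≤n
  prependPair-length (suc x) zero    _ = s≤s z≤n
  prependPair-length (suc x) (suc y) _ = ℕ.≤-refl

  weightExp-prependPair : ∀ {x y r} → y ≤ x → (y ≡ 0 → r ≡ []) →
    weightExp (prependPair x y r) ≡ (⌈ x /2⌉ , ⌊ x /2⌋ , ⌈ y /2⌉ , ⌊ y /2⌋) +ᵉ weightExp r
  weightExp-prependPair {zero}  {zero}  z≤n r≡[] rewrite r≡[] refl = refl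
  weightExp-prependPair {suc x} {zero}  _   r≡[] rewrite r≡[] refl = sym (+ᵉ-identityʳ _)
  weightExp-prependPair {suc x} {suc y} _   _    = refl

  -- The code ((β , s) , v) of block t stands for the parts (2u + 2s + β , 2u), where
  -- u = v + height of the later codes = ⌈λ_{2t+3}/2⌉.
  Code : Set
  Code = (Bit × ℕ) × ℕ

  height : Vec Code n → ℕ
  height []                   = 0
  height (((β , s) , v) ∷ cs) = bit β + s + v + height cs

  block : Bit → ℕ → ℕ → List ℕ → List ℕ
  block β s u = prependPair (u + u + (s + s + bit β)) (u + u)

  decode : Vec Code n → List ℕ
  decode []                   = []
  decode (((β , s) , v) ∷ cs) = block β s (v + height cs) (decode cs)

  blockCode : ℕ → ℕ → List ℕ → Code
  blockCode x y r = (parity (x ∸ y) , ⌊ x ∸ y /2⌋) , ⌊ y /2⌋ ∸ ⌈ largestPart r /2⌉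

  encode : (n : ℕ) → List ℕ → Vec Code n
  encode zero    _  = []
  encode (suc n) λs = let (x , y , r) = splitPair λs in blockCode x y r ∷ encode n r

  u+u+[s+s+β]≡[u+s]+[u+s]+β : ∀ u s β → u + u + (s + s + β) ≡ (u + s) + (u + s) + β
  u+u+[s+s+β]≡[u+s]+[u+s]+β = solve-∀

  ⌈largestPart-block/2⌉ : ∀ β s u R → ⌈ largestPart (block β s u R) /2⌉ ≡ bit β + s + u
  ⌈largestPart-block/2⌉ β s u R = begin
    ⌈ largestPart (block β s u R) /2⌉         ≡⟨ cong ⌈_/2⌉ (largestPart-prependPair _ (u + u) R) ⟩
    ⌈ u + u + (s + s + bit β) /2⌉            ≡⟨ cong ⌈_/2⌉ (u+u+[s+s+β]≡[u+s]+[u+s]+β u s (bit β)) ⟩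
    ⌈ (u + s) + (u + s) + bit β /2⌉          ≡⟨ ⌈m+m+β/2⌉≡m+β (u + s) β ⟩
    u + s + bit β                            ≡⟨ reverse u s (bit β) ⟩
    bit β + s + u                            ∎
    where
    open ≡-Reasoning
    reverse : ∀ a b c → a + b + c ≡ c + b + a
    reverse = solve-∀

  ⌈largestPart-decode/2⌉ : ∀ (cs : Vec Code n) → ⌈ largestPart (decode cs) /2⌉ ≡ height cs
  ⌈largestPart-decode/2⌉ []                   = refl
  ⌈largestPart-decode/2⌉ (((β , s) , v) ∷ cs) =
    trans (⌈largestPart-block/2⌉ β s (v + height cs) (decode cs)) (sym (ℕ.+-assoc (bit β + s) v (height cs)))

  decode-positive : ∀ (cs : Vec Code n) → Positive (decode cs)
  decode-positive []                   = []
  decode-positive (((β , s) , v) ∷ cs) = prependPair-positive _ _ (decode-positive cs)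

  positive-⌈largestPart/2⌉≡0 : ∀ {λs} → Positive λs → ⌈ largestPart λs /2⌉ ≡ 0 → λs ≡ []
  positive-⌈largestPart/2⌉≡0 {[]}    _           _  = refl
  positive-⌈largestPart/2⌉≡0 {suc _ ∷ _} (s≤s _ ∷ _) ()

  decode-empty : ∀ (cs : Vec Code n) → height cs ≡ 0 → decode cs ≡ []
  decode-empty cs h≡0 = positive-⌈largestPart/2⌉≡0 (decode-positive cs) (trans (⌈largestPart-decode/2⌉ cs) h≡0)

  decode-evenIndexedEven : ∀ (cs : Vec Code n) → EvenIndexedEven (decode cs)
  decode-evenIndexedEven []                   = tt
  decode-evenIndexedEven (((β , s) , v) ∷ cs) =
    prependPair-evenIndexedEven _ (u + u) (divides u (u+u≡u*2 u)) (decode-evenIndexedEven cs)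
    where
    u = v + height cs
    u+u≡u*2 : ∀ u → u + u ≡ u * 2
    u+u≡u*2 = solve-∀

  n≤⌈n/2⌉+⌈n/2⌉ : ∀ n → n ≤ ⌈ n /2⌉ + ⌈ n /2⌉
  n≤⌈n/2⌉+⌈n/2⌉ n = ℕ.≤-trans (ℕ.≤-reflexive (sym (ℕ.⌊n/2⌋+⌈n/2⌉≡n n))) (ℕ.+-monoˡ-≤ ⌈ n /2⌉ (ℕ.⌊n/2⌋≤⌈n/2⌉ n))

  decode-linked : ∀ (cs : Vec Code n) → Linked ℕ._≥_ (decode cs)
  decode-linked []                   = []
  decode-linked (((β , s) , v) ∷ cs) =
    prependPair-linked (ℕ.m≤m+n (u + u) _) largest≤u+u (decode-linked cs)
    where
    u = v + height cs
    ⌈largest/2⌉≤u : ⌈ largestPart (decode cs) /2⌉ ≤ u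
    ⌈largest/2⌉≤u = ℕ.≤-trans (ℕ.≤-reflexive (⌈largestPart-decode/2⌉ cs)) (ℕ.m≤n+m (height cs) v)
    largest≤u+u : largestPart (decode cs) ≤ u + u
    largest≤u+u = ℕ.≤-trans (n≤⌈n/2⌉+⌈n/2⌉ _) (ℕ.+-mono-≤ ⌈largest/2⌉≤u ⌈largest/2⌉≤u)

  decode-InP1 : ∀ (cs : Vec Code n) → InP1 (decode cs)
  decode-InP1 cs = (decode-linked cs , decode-positive cs) , decode-evenIndexedEven cs

  decode-length : ∀ (cs : Vec Code n) → length (decode cs) ≤ n + n
  decode-length []                       = z≤n
  decode-length {suc n} (((β , s) , v) ∷ cs) = begin
    length (decode (((β , s) , v) ∷ cs)) ≤⟨ prependPair-length (u + u + (s + s + bit β)) (u + u) (decode cs) ⟩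
    2 + length (decode cs)               ≤⟨ s≤s (s≤s (decode-length cs)) ⟩
    2 + (n + n)                          ≡⟨ cong suc (sym (ℕ.+-suc n n)) ⟩
    suc n + suc n                        ∎
    where
    open ℕ.≤-Reasoning
    u = v + height cs

  weightExp-block : ∀ β s u R → (u ≡ 0 → R ≡ []) →
                    weightExp (block β s u R) ≡ (u + s + bit β , u + s , u , u) +ᵉ weightExp R
  weightExp-block β s u R u≡0⇒R≡[] =
    trans (weightExp-prependPair (ℕ.m≤m+n (u + u) _) (λ u+u≡0 → u≡0⇒R≡[] (ℕ.m+n≡0⇒m≡0 u u+u≡0)))
          (cong (_+ᵉ weightExp R) (Exp-≡ ⌈x/2⌉ ⌊x/2⌋ (sym (ℕ.n≡⌈n+n/2⌉ u)) (sym (ℕ.n≡⌊n+n/2⌋ u))))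
    where
    x≡ : u + u + (s + s + bit β) ≡ (u + s) + (u + s) + bit β
    x≡ = u+u+[s+s+β]≡[u+s]+[u+s]+β u s (bit β)
    ⌈x/2⌉ : ⌈ u + u + (s + s + bit β) /2⌉ ≡ u + s + bit β
    ⌈x/2⌉ = trans (cong ⌈_/2⌉ x≡) (⌈m+m+β/2⌉≡m+β (u + s) β)
    ⌊x/2⌋ : ⌊ u + u + (s + s + bit β) /2⌋ ≡ u + s
    ⌊x/2⌋ = trans (cong ⌊_/2⌋ x≡) (⌊m+m+β/2⌋≡m (u + s) β)

  bitWeight : ℕ → Bit → Exp
  bitWeight o = [ (λ _ → 0 , 0 , 0 , 0) , (λ _ → suc o , o , o , o) ]

  abWeight : ℕ → ℕ → Exp
  abWeight o s = s * suc o , s * suc o , s * o , s * o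

  QWeight : ℕ → ℕ → Exp
  QWeight o v = v * suc o , v * suc o , v * suc o , v * suc o

  codeWeight : ℕ → Code → Exp
  codeWeight o ((β , s) , v) = (bitWeight o β +ᵉ abWeight o s) +ᵉ QWeight o v

  Qᵉ : ℕ → Exp
  Qᵉ t = t , t , t , t

  bitWeight≡ : ∀ o β → bitWeight o β ≡ (bit β * suc o , bit β * o , bit β * o , bit β * o)
  bitWeight≡ o bit0 = refl
  bitWeight≡ o bit1 = sym (Exp-≡ (ℕ.+-identityʳ _) (ℕ.+-identityʳ o) (ℕ.+-identityʳ o) (ℕ.+-identityʳ o))

  -- Moving the tail from position o + 1 to position o frees a factor Q^h, h the height of the tail;
  -- it raises v to u = v + h in the block.
  codeWeight-shift : ∀ o β s v h (W : Exp) →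
    (((bit β * suc o , bit β * o , bit β * o , bit β * o) +ᵉ abWeight o s) +ᵉ QWeight o v) +ᵉ (W +ᵉ Qᵉ (suc o * h))
    ≡ ((v + h + s + bit β , v + h + s , v + h , v + h) +ᵉ W) +ᵉ Qᵉ (o * (bit β + s + v + h))
  codeWeight-shift o β s v h (w₁ , w₂ , w₃ , w₄) = Exp-≡ (first o (bit β) s v h w₁) (second o (bit β) s v h w₂)
                                                          (rest o (bit β) s v h w₃) (rest o (bit β) s v h w₄)
    where
    first : ∀ o β s v h w →
            β * suc o + s * suc o + v * suc o + (w + suc o * h) ≡ v + h + s + β + w + o * (β + s + v + h)
    first = solve-∀
    second : ∀ o β s v h w → β * o + s * suc o + v * suc o + (w + suc o * h) ≡ v + h + s + w + o * (β + s + v + h)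
    second = solve-∀
    rest : ∀ o β s v h w → β * o + s * o + v * suc o + (w + suc o * h) ≡ v + h + w + o * (β + s + v + h)
    rest = solve-∀

  decode-weight : ∀ o (cs : Vec Code n) → indexedWeight codeWeight o cs ≡ weightExp (decode cs) +ᵉ Qᵉ (o * height cs)
  decode-weight o [] = Exp-≡ (sym (ℕ.*-zeroʳ o)) (sym (ℕ.*-zeroʳ o)) (sym (ℕ.*-zeroʳ o)) (sym (ℕ.*-zeroʳ o))
  decode-weight o (((β , s) , v) ∷ cs) = begin
    codeWeight o ((β , s) , v) +ᵉ indexedWeight codeWeight (suc o) cs
      ≡⟨ cong₂ (λ b W → ((b +ᵉ abWeight o s) +ᵉ QWeight o v) +ᵉ W) (bitWeight≡ o β) (decode-weight (suc o) cs) ⟩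
    (((bit β * suc o , bit β * o , bit β * o , bit β * o) +ᵉ abWeight o s) +ᵉ QWeight o v)
      +ᵉ (weightExp (decode cs) +ᵉ Qᵉ (suc o * height cs))
      ≡⟨ codeWeight-shift o β s v (height cs) (weightExp (decode cs)) ⟩
    ((u + s + bit β , u + s , u , u) +ᵉ weightExp (decode cs)) +ᵉ Qᵉ (o * (bit β + s + v + height cs))
      ≡⟨ cong (_+ᵉ Qᵉ (o * (bit β + s + v + height cs)))
              (sym (weightExp-block β s u (decode cs) (decode-empty cs ∘ ℕ.m+n≡0⇒n≡0 v))) ⟩
    weightExp (block β s u (decode cs)) +ᵉ Qᵉ (o * (bit β + s + v + height cs))
      ∎
    where
    open ≡-Reasoning
    u = v + height cs

  blockCode-block : ∀ β s v (cs : Vec Code n) → let u = v + height cs in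
    blockCode (u + u + (s + s + bit β)) (u + u) (decode cs) ≡ ((β , s) , v)
  blockCode-block β s v cs = cong₂ _,_ (cong₂ _,_ (trans (cong parity d≡) (parity-m+m+β s β))
                                                (trans (cong ⌊_/2⌋ d≡) (⌊m+m+β/2⌋≡m s β))) v≡
    where
    u = v + height cs
    d≡ : u + u + (s + s + bit β) ∸ (u + u) ≡ s + s + bit β
    d≡ = ℕ.m+n∸m≡n (u + u) (s + s + bit β)
    v≡ : ⌊ u + u /2⌋ ∸ ⌈ largestPart (decode cs) /2⌉ ≡ v
    v≡ = trans (cong₂ _∸_ (sym (ℕ.n≡⌊n+n/2⌋ u)) (⌈largestPart-decode/2⌉ cs)) (ℕ.m+n∸n≡m v (height cs))

  encode-prependPair : ∀ {x y r} → y ≤ x → (y ≡ 0 → r ≡ []) →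
                       encode (suc n) (prependPair x y r) ≡ blockCode x y r ∷ encode n r
  encode-prependPair y≤x y≡0⇒r≡[] rewrite splitPair-prependPair y≤x y≡0⇒r≡[] = refl

  encode-decode : ∀ (cs : Vec Code n) → encode n (decode cs) ≡ cs
  encode-decode []                   = refl
  encode-decode (((β , s) , v) ∷ cs) =
    trans (encode-prependPair (ℕ.m≤m+n (u + u) _) (decode-empty cs ∘ ℕ.m+n≡0⇒n≡0 v ∘ ℕ.m+n≡0⇒m≡0 u))
          (cong₂ _∷_ (blockCode-block β s v cs) (encode-decode cs))
    where u = v + height cs

  decode-blockCode : ∀ {x y m r} (cs : Vec Code n) → decode cs ≡ r → y ≡ m + m → y ≤ x →
                     ⌈ largestPart r /2⌉ ≤ m → decode (blockCode x y r ∷ cs) ≡ prependPair x y r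
  decode-blockCode {x = x} {y} {m} cs refl y≡m+m y≤x h≤m = begin
    block (parity d) ⌊ d /2⌋ (⌊ y /2⌋ ∸ h + height cs) (decode cs)
      ≡⟨ cong (λ u → block (parity d) ⌊ d /2⌋ u (decode cs)) u≡m ⟩
    prependPair (m + m + (⌊ d /2⌋ + ⌊ d /2⌋ + bit (parity d))) (m + m) (decode cs)
      ≡⟨ cong₂ (λ a b → prependPair a b (decode cs)) x≡ (sym y≡m+m) ⟩
    prependPair x y (decode cs)
      ∎
    where
    open ≡-Reasoning
    d = x ∸ y
    h = ⌈ largestPart (decode cs) /2⌉
    u≡m : ⌊ y /2⌋ ∸ h + height cs ≡ m
    u≡m = trans (cong₂ _+_ (cong (_∸ h) (trans (cong ⌊_/2⌋ y≡m+m) (sym (ℕ.n≡⌊n+n/2⌋ m))))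
                           (sym (⌈largestPart-decode/2⌉ cs)))
                (ℕ.m∸n+n≡m h≤m)
    x≡ : m + m + (⌊ d /2⌋ + ⌊ d /2⌋ + bit (parity d)) ≡ x
    x≡ = trans (cong₂ _+_ (sym y≡m+m) (⌊n/2⌋+⌊n/2⌋+parity≡n d)) (ℕ.m+[n∸m]≡n y≤x)

  linked-largestPart : ∀ {y r} → Linked ℕ._≥_ (y ∷ r) → largestPart r ≤ y
  linked-largestPart [-]       = z≤n
  linked-largestPart (r≤y ∷ _) = r≤y

  InP1-drop₂ : ∀ {x y r} → InP1 (x ∷ y ∷ r) → InP1 r
  InP1-drop₂ ((_ ∷ lnk , _ ∷ _ ∷ pos) , _ , ev) = (Linked.tail lnk , pos) , ev

  decode-encode : ∀ n {λs} → InP1 λs → length λs ≤ n + n → decode (encode n λs) ≡ λs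
  decode-encode zero    {[]}    _ _  = refl
  decode-encode zero    {_ ∷ _} _ ()
  decode-encode (suc n) {[]}    _ _ =
    decode-blockCode {x = 0} {m = 0} (encode n []) (decode-encode n (([] , []) , tt) z≤n) refl z≤n z≤n
  decode-encode (suc n) {zero ∷ []} ((_ , () ∷ _) , _) _
  decode-encode (suc n) {suc x ∷ []} _ _ =
    decode-blockCode {x = suc x} {m = 0} (encode n []) (decode-encode n (([] , []) , tt) z≤n) refl z≤n z≤n
  decode-encode (suc n) {x ∷ y ∷ r} inP1@((y≤x ∷ lnk , 0<x ∷ 0<y ∷ _) , divides m y≡m*2 , _) len =
    trans (decode-blockCode (encode n r) (decode-encode n (InP1-drop₂ inP1) len′) y≡m+m y≤x h≤m)
          (prependPair-positive≡ 0<x 0<y)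
    where
    y≡m+m : y ≡ m + m
    y≡m+m = trans y≡m*2 (trans (ℕ.*-comm m 2) (cong (m ℕ.+_) (ℕ.+-identityʳ m)))
    len′ : length r ≤ n + n
    len′ = ℕ.≤-pred (ℕ.≤-trans (ℕ.≤-pred len) (ℕ.≤-reflexive (ℕ.+-suc n n)))
    h≤m : ⌈ largestPart r /2⌉ ≤ m
    h≤m = ℕ.≤-trans (ℕ.⌈n/2⌉-mono (ℕ.≤-trans (linked-largestPart lnk) (ℕ.≤-reflexive y≡m+m)))
                    (ℕ.≤-reflexive (sym (ℕ.n≡⌈n+n/2⌉ m)))
    prependPair-positive≡ : 0 < x → 0 < y → prependPair x y r ≡ x ∷ y ∷ r
    prependPair-positive≡ (s≤s _) (s≤s _) = refl

  decode-bijection : ∀ {n} {Pc : Vec Code n → Set} {Pl : List ℕ → Set} →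
    (∀ {cs} → Pc cs → Pl (decode cs)) →
    (∀ {λs} → InP1 λs → Pl λs → length λs ≤ n + n × Pc (encode n λs)) →
    WeightedBijection Pc (indexedWeight codeWeight 0) (λ λs → InP1 λs × Pl λs) weightExp
  decode-bijection {n} Pc⇒Pl Pl⇒Pc = record
    { to         = decode
    ; injective  = λ {cs} {cs'} _ _ eq → trans (sym (encode-decode cs)) (trans (cong (encode n) eq) (encode-decode cs'))
    ; to-∈       = λ {cs} pc → decode-InP1 cs , Pc⇒Pl pc
    ; weight     = λ {cs} _ → sym (trans (decode-weight 0 cs) (+ᵉ-identityʳ _))
    ; surjective = λ {λs} (inP1 , pl) → let (len , pc) = Pl⇒Pc inP1 pl in
                     encode n λs , pc , sym (decode-encode n inP1 len)
    }

  bits-generates : ∀ t → Generates (oneS ⊕ aQpow t) (λ (_ : Bit) → ⊤) (bitWeight t)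
  bits-generates t = Generates-⇔ (λ { bit0 → mk⇔ (λ _ → tt) (λ _ → tt) ; bit1 → mk⇔ (λ _ → tt) (λ _ → tt) })
                       (⊕-generates (mono-generates 0 0 0 0) (mono-generates (suc t) t t t))

  ab-generates : ∀ t → Generates (geomInv (suc t) (suc t) t t) (λ (_ : ℕ) → ⊤) (abWeight t)
  ab-generates t = geomInv-generates t (suc t) t t

  Q-generates : ∀ t → Generates (geomInv (suc t) (suc t) (suc t) (suc t)) (λ (_ : ℕ) → ⊤) (QWeight t)
  Q-generates t = geomInv-generates t (suc t) (suc t) (suc t)

  rhsPartial-codes : ∀ N → Generates (rhsPartial N) (λ (_ : Vec Code N) → ⊤) (indexedWeight codeWeight 0)
  rhsPartial-codes N =
    ⊛-zip-generates (⊛-zip-generates (prodS-generates bits-generates N) (prodS-generates ab-generates N))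
                    (prodS-generates Q-generates N)

  rhsPartial-generates : ∀ N → Generates (rhsPartial N) (λ λs → InP1 λs × length λs ≤ N + N) weightExp
  rhsPartial-generates N =
    Generates-bijection (decode-bijection (λ {cs} _ → decode-length cs) (λ _ len → len , tt)) (rhsPartial-codes N)

  -- A final odd part λ_ℓ with ℓ odd counts twice, as if followed by a part λ_{ℓ+1} = 0.
  effectiveLength : List ℕ → ℕ
  effectiveLength []          = 0
  effectiveLength (x ∷ [])    = suc (bit (parity x))
  effectiveLength (x ∷ y ∷ r) = suc (suc (effectiveLength r))

  length≤effectiveLength : ∀ λs → length λs ≤ effectiveLength λs
  length≤effectiveLength []          = z≤n
  length≤effectiveLength (x ∷ [])    = s≤s z≤n
  length≤effectiveLength (x ∷ y ∷ r) = s≤s (s≤s (length≤effectiveLength r))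

  effectiveLength≤1+length : ∀ λs → effectiveLength λs ≤ suc (length λs)
  effectiveLength≤1+length []          = z≤n
  effectiveLength≤1+length (x ∷ [])    with parity x
  ... | bit0 = s≤s z≤n
  ... | bit1 = s≤s (s≤s z≤n)
  effectiveLength≤1+length (x ∷ y ∷ r) = s≤s (s≤s (effectiveLength≤1+length r))

  effectiveLength-block : ∀ β s u R → 0 < u → effectiveLength (block β s u R) ≡ suc (suc (effectiveLength R))
  effectiveLength-block β s (suc u) R _ = refl

  AtLast : (Code → Set) → Vec Code n → Set
  AtLast P []           = ⊤
  AtLast P (c ∷ [])     = P c
  AtLast P (c ∷ c' ∷ cs) = AtLast P (c' ∷ cs)

  -- The last block has two nonzero parts, or a single odd one.
  FullBlock : Code → Set
  FullBlock ((bit1 , _) , _)     = ⊤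
  FullBlock ((bit0 , _) , suc _) = ⊤
  FullBlock ((bit0 , _) , zero)  = ⊥

  -- The last block is a single nonzero even part.
  HalfBlock : Code → Set
  HalfBlock ((bit0 , suc _) , zero) = ⊤
  HalfBlock _                       = ⊥

  AtLast-∷⁻ : ∀ {P c} (cs : Vec Code (suc n)) → AtLast P (c ∷ cs) → AtLast P cs
  AtLast-∷⁻ (_ ∷ _) p = p

  AtLast-∷⁺ : ∀ {P c} (cs : Vec Code (suc n)) → AtLast P cs → AtLast P (c ∷ cs)
  AtLast-∷⁺ (_ ∷ _) p = p

  AtLast-height : ∀ {P} → (∀ {c} → P c → 0 < height (c ∷ [])) →
                  ∀ c (cs : Vec Code n) → AtLast P (c ∷ cs) → 0 < height (c ∷ cs)
  AtLast-height P⇒0<h c []         pc  = P⇒0<h pc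
  AtLast-height P⇒0<h ((β , s) , v) (c' ∷ cs) pcs =
    ℕ.≤-trans (AtLast-height P⇒0<h c' cs pcs) (ℕ.m≤n+m (height (c' ∷ cs)) (bit β + s + v))

  FullBlock-height : ∀ {c} → FullBlock c → 0 < height (c ∷ [])
  FullBlock-height {(bit1 , _) , _}     _ = s≤s z≤n
  FullBlock-height {(bit0 , s) , suc v} _ =
    ℕ.≤-trans (s≤s z≤n) (ℕ.≤-reflexive (sym (trans (ℕ.+-identityʳ _) (ℕ.+-suc s v))))

  HalfBlock-height : ∀ {c} → HalfBlock c → 0 < height (c ∷ [])
  HalfBlock-height {(bit0 , suc s) , zero} _ = s≤s z≤n

  prependPair-single : ∀ {x} → 0 < x → prependPair x 0 [] ≡ x ∷ []
  prependPair-single {suc x} _ = refl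

  effectiveLength-decode-full : ∀ (cs : Vec Code n) → AtLast FullBlock cs → effectiveLength (decode cs) ≡ n + n
  effectiveLength-decode-full []                          _ = refl
  effectiveLength-decode-full (((bit1 , s) , zero) ∷ [])  _ =
    trans (cong effectiveLength (prependPair-single (ℕ.m≤n+m 1 (s + s)))) (cong (suc ∘ bit) (parity-m+m+β s bit1))
  effectiveLength-decode-full (((bit1 , s) , suc v) ∷ []) _ = refl
  effectiveLength-decode-full (((bit0 , s) , suc v) ∷ []) _ = refl
  effectiveLength-decode-full {suc (suc n)} (((β , s) , v) ∷ c' ∷ cs) full = begin
    effectiveLength (block β s (v + height (c' ∷ cs)) (decode (c' ∷ cs)))
      ≡⟨ effectiveLength-block β s _ _ (ℕ.≤-trans (AtLast-height FullBlock-height c' cs full) (ℕ.m≤n+m _ v)) ⟩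
    suc (suc (effectiveLength (decode (c' ∷ cs))))
      ≡⟨ cong (suc ∘ suc) (effectiveLength-decode-full (c' ∷ cs) full) ⟩
    suc (suc (suc n + suc n))
      ≡⟨ cong suc (sym (ℕ.+-suc (suc n) (suc n))) ⟩
    suc (suc n) + suc (suc n)
      ∎
    where open ≡-Reasoning

  effectiveLength-decode-half : ∀ (cs : Vec Code (suc n)) → AtLast HalfBlock cs →
                                effectiveLength (decode cs) ≡ suc (n + n)
  effectiveLength-decode-half (((bit0 , suc s) , zero) ∷ []) _ = cong (suc ∘ bit) (parity-m+m+β (suc s) bit0)
  effectiveLength-decode-half {suc n} (((β , s) , v) ∷ c' ∷ cs) half = begin
    effectiveLength (block β s (v + height (c' ∷ cs)) (decode (c' ∷ cs)))
      ≡⟨ effectiveLength-block β s _ _ (ℕ.≤-trans (AtLast-height HalfBlock-height c' cs half) (ℕ.m≤n+m _ v)) ⟩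
    suc (suc (effectiveLength (decode (c' ∷ cs))))
      ≡⟨ cong (suc ∘ suc) (effectiveLength-decode-half (c' ∷ cs) half) ⟩
    suc (suc (suc (n + n)))
      ≡⟨ cong (suc ∘ suc) (sym (ℕ.+-suc n n)) ⟩
    suc (suc n + suc n)
      ∎
    where open ≡-Reasoning

  effectiveLength≡0 : ∀ {λs} → effectiveLength λs ≡ 0 → λs ≡ []
  effectiveLength≡0 {[]}        _ = refl
  effectiveLength≡0 {x ∷ []}    ()
  effectiveLength≡0 {x ∷ y ∷ r} ()

  ¬2∣1 : ¬ (2 ∣ 1)
  ¬2∣1 (divides zero    ())
  ¬2∣1 (divides (suc q) ())

  encode-full : ∀ n {λs} → InP1 λs → effectiveLength λs ≡ n + n → AtLast FullBlock (encode n λs)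
  encode-full zero                           _ _ = tt
  encode-full (suc n)       {[]}             _ ()
  encode-full (suc zero)    {x ∷ []}         _ eq with parity x
  encode-full (suc zero)    {x ∷ []}         _ () | bit0
  ... | bit1 = tt
  encode-full (suc (suc n)) {x ∷ []}         _ eq with parity x
  encode-full (suc (suc n)) {x ∷ []}         _ () | bit0
  ... | bit1 = ⊥-elim (ℕ.m+1+n≢0 n (sym (ℕ.suc-injective (ℕ.suc-injective eq))))
  encode-full (suc zero)    {x ∷ zero ∷ r}   ((_ , _ ∷ () ∷ _) , _) _
  encode-full (suc zero)    {x ∷ suc zero ∷ r} (_ , 2∣1 , _) _ = ⊥-elim (¬2∣1 2∣1)
  encode-full (suc zero)    {x ∷ suc (suc y) ∷ r} _ eq
    rewrite effectiveLength≡0 {r} (ℕ.suc-injective (ℕ.suc-injective eq)) with parity (x ∸ suc (suc y))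
  ... | bit0 = tt
  ... | bit1 = tt
  encode-full (suc (suc n)) {x ∷ y ∷ r}      inP1 eq =
    encode-full (suc n) (InP1-drop₂ inP1) (ℕ.suc-injective (trans (ℕ.suc-injective eq) (ℕ.+-suc (suc n) (suc n))))

  encode-half : ∀ n {λs} → InP1 λs → effectiveLength λs ≡ suc (n + n) → AtLast HalfBlock (encode (suc n) λs)
  encode-half n       {[]}                  _ ()
  encode-half zero    {zero ∷ []}           ((_ , () ∷ _) , _) _
  encode-half zero    {suc zero ∷ []}       _ ()
  encode-half zero    {suc (suc x) ∷ []}    _ eq with parity x
  ... | bit0 = tt
  encode-half zero    {suc (suc x) ∷ []}    _ () | bit1
  encode-half (suc m) {x ∷ []}              _ eq with parity x
  encode-half (suc m) {x ∷ []}              _ () | bit0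
  ... | bit1 = ⊥-elim (ℕ.m+1+n≢0 m (sym (ℕ.suc-injective (ℕ.suc-injective eq))))
  encode-half zero    {x ∷ y ∷ r}           _ ()
  encode-half (suc m) {x ∷ y ∷ r}           inP1 eq =
    encode-half m (InP1-drop₂ inP1) (ℕ.suc-injective (trans (ℕ.suc-injective eq) (ℕ.+-suc (suc m) m)))

  AtLast-∷ʳ : ∀ {P c} (cs : Vec Code n) → P c → AtLast P (cs ∷ʳ c)
  AtLast-∷ʳ []            pc = pc
  AtLast-∷ʳ (c' ∷ [])     pc = pc
  AtLast-∷ʳ (c' ∷ c″ ∷ cs) pc = AtLast-∷ʳ (c″ ∷ cs) pc

  ∷ʳ-AtLast : ∀ {P c} (cs : Vec Code n) → AtLast P (cs ∷ʳ c) → P c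
  ∷ʳ-AtLast []            pc = pc
  ∷ʳ-AtLast (c' ∷ [])     pc = pc
  ∷ʳ-AtLast (c' ∷ c″ ∷ cs) pc = ∷ʳ-AtLast (c″ ∷ cs) pc

  halfBlock : ℕ → Code
  halfBlock s = (bit0 , suc s) , 0

  HalfBlock⇒≡halfBlock : ∀ {c} → HalfBlock c → ∃[ s ] (c ≡ halfBlock s)
  HalfBlock⇒≡halfBlock {(bit0 , suc s) , zero} _ = s , refl

  codeWeight-halfBlock : ∀ o s → codeWeight o (halfBlock s) ≡ (suc o , suc o , o , o) +ᵉ abWeight o s
  codeWeight-halfBlock o s = Exp-≡ (ab o s) (ab o s) (c o s) (c o s)
    where
    ab : ∀ o s → 0 + suc s * suc o + 0 * suc o ≡ suc o + s * suc o
    ab = solve-∀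
    c : ∀ o s → 0 + suc s * o + 0 * suc o ≡ o + s * o
    c = solve-∀

  -- The factor abQ^n and the last factor 1/(1 - abQ^n) of 1/(ab;Q)_{n+1} together make the last block halfBlock s.
  term2-codes : ∀ n → Generates (term2 n) (AtLast HalfBlock) (indexedWeight codeWeight 0)
  term2-codes n = Generates-bijection appendHalfBlock
    (⊛-generates (⊛-generates (⊛-generates (mono-generates (suc n) (suc n) n n) (prodS-generates bits-generates n))
                               (⊛-generates (prodS-generates ab-generates n) (ab-generates n)))
                 (prodS-generates Q-generates n))
    where
    Choice : Set
    Choice = ((⊤ × Vec Bit n) × (Vec ℕ n × ℕ)) × Vec ℕ n
    choiceWeight : Choice → Exp
    choiceWeight (((_ , bs) , (ss , s)) , vs) =
      (((suc n , suc n , n , n) +ᵉ indexedWeight bitWeight 0 bs) +ᵉ (indexedWeight abWeight 0 ss +ᵉ abWeight n s))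
      +ᵉ indexedWeight QWeight 0 vs
    codes : Vec Bit n → Vec ℕ n → Vec ℕ n → Vec Code n
    codes bs ss vs = zip (zip bs ss) vs
    toCodes : Choice → Vec Code (suc n)
    toCodes (((_ , bs) , (ss , s)) , vs) = codes bs ss vs ∷ʳ halfBlock s
    toCodes-injective : ∀ {x x'} → toCodes x ≡ toCodes x' → x ≡ x'
    toCodes-injective {((_ , bs) , (ss , s)) , vs} {((_ , bs') , (ss' , s')) , vs'} eq =
      let (codes≡ , last≡) = ∷ʳ-injective (codes bs ss vs) (codes bs' ss' vs') eq
          (bss≡ , vs≡)     = zip-injective codes≡
          (bs≡ , ss≡)      = zip-injective bss≡
      in cong₂ _,_ (cong₂ _,_ (cong (tt ,_) bs≡) (cong₂ _,_ ss≡ (cong (ℕ.pred ∘ proj₂ ∘ proj₁) last≡))) vs≡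
    toCodes-weight : ∀ x → indexedWeight codeWeight 0 (toCodes x) ≡ choiceWeight x
    toCodes-weight (((_ , bs) , (ss , s)) , vs) = begin
      indexedWeight codeWeight 0 (codes bs ss vs ∷ʳ halfBlock s)
        ≡⟨ indexedWeight-∷ʳ codeWeight 0 (codes bs ss vs) (halfBlock s) ⟩
      indexedWeight codeWeight 0 (codes bs ss vs) +ᵉ codeWeight n (halfBlock s)
        ≡⟨ cong₂ _+ᵉ_ (trans (indexedWeight-zip _ QWeight 0 (zip bs ss) vs)
                             (cong (_+ᵉ V) (indexedWeight-zip bitWeight abWeight 0 bs ss)))
                      (codeWeight-halfBlock n s) ⟩
      ((B +ᵉ A) +ᵉ V) +ᵉ (abQⁿ +ᵉ a)
        ≡⟨ solve 5 (λ B A V abQⁿ a → ((B ⊞ A) ⊞ V) ⊞ (abQⁿ ⊞ a) ⊜ ((abQⁿ ⊞ B) ⊞ (A ⊞ a)) ⊞ V) refl B A V abQⁿ a ⟩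
      ((abQⁿ +ᵉ B) +ᵉ (A +ᵉ a)) +ᵉ V
        ∎
      where
      open ≡-Reasoning
      open +ᵉ-Solver using (solve; _⊜_; _⊞_)
      B = indexedWeight bitWeight 0 bs
      A = indexedWeight abWeight 0 ss
      V = indexedWeight QWeight 0 vs
      abQⁿ = (suc n , suc n , n , n)
      a = abWeight n s
    toCodes-surjective : ∀ cs → AtLast HalfBlock cs → ∃[ x ] ((((⊤ × ⊤) × (⊤ × ⊤)) × ⊤) × cs ≡ toCodes x)
    toCodes-surjective cs half with initLast cs
    ... | init , c , refl with HalfBlock⇒≡halfBlock (∷ʳ-AtLast init half)
    ... | s , refl = let (bss , vs) = unzip init ; (bs , ss) = unzip bss in
      (((tt , bs) , (ss , s)) , vs) , (((tt , tt) , (tt , tt)) , tt) ,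
      cong (_∷ʳ halfBlock s) (sym (trans (cong (λ z → zip z vs) (zip∘unzip bss)) (zip∘unzip init)))
    appendHalfBlock : WeightedBijection (λ _ → ((⊤ × ⊤) × (⊤ × ⊤)) × ⊤) choiceWeight
                                        (AtLast HalfBlock) (indexedWeight codeWeight 0)
    appendHalfBlock = record
      { to         = toCodes
      ; injective  = λ _ _ → toCodes-injective
      ; to-∈       = λ { {((_ , bs) , (ss , s)) , vs} _ → AtLast-∷ʳ (codes bs ss vs) tt }
      ; weight     = λ {x} _ → toCodes-weight x
      ; surjective = λ {cs} → toCodes-surjective cs
      }

  term2-generates : ∀ n → Generates (term2 n) (λ λs → InP1 λs × effectiveLength λs ≡ suc (n + n)) weightExp
  term2-generates n = Generates-bijection
    (decode-bijection (λ {cs} half → effectiveLength-decode-half cs half)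
                      (λ {λs} inP1 eq → ℕ.≤-trans (length≤effectiveLength λs) (ℕ.≤-trans (ℕ.≤-reflexive eq) 2n+1≤)
                                      , encode-half n inP1 eq))
    (term2-codes n)
    where
    2n+1≤ : suc (n + n) ≤ suc n + suc n
    2n+1≤ = s≤s (ℕ.+-monoʳ-≤ n (ℕ.n≤1+n n))

  bitWeight₁ : ℕ → Bit → Exp
  bitWeight₁ o = [ (λ _ → 1 , 1 , 1 , 1) , (λ _ → suc o , o , o , o) ]

  bits₁-generates : ∀ t → Generates (Qpow 1 ⊕ aQpow t) (λ (_ : Bit) → ⊤) (bitWeight₁ t)
  bits₁-generates t = Generates-⇔ (λ { bit0 → mk⇔ (λ _ → tt) (λ _ → tt) ; bit1 → mk⇔ (λ _ → tt) (λ _ → tt) })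
                        (⊕-generates (mono-generates 1 1 1 1) (mono-generates (suc t) t t t))

  codeWeight₁ : ℕ → Code → Exp
  codeWeight₁ o ((β , s) , v) = (bitWeight₁ o β +ᵉ abWeight o s) +ᵉ QWeight o v

  bitWeight₁-suc : ∀ o β → bitWeight₁ (suc o) β ≡ Qᵉ 1 +ᵉ bitWeight o β
  bitWeight₁-suc o bit0 = refl
  bitWeight₁-suc o bit1 = refl

  lastBlock : Bit → ℕ → ℕ → Code
  lastBlock bit0 s v = (bit0 , s) , suc v
  lastBlock bit1 s v = (bit1 , s) , v

  -- Inverse of lastBlock on FullBlock codes (the identity, i.e. junk, on the others).
  unLastBlock : Code → Code
  unLastBlock ((bit0 , s) , suc v) = (bit0 , s) , v
  unLastBlock c                    = c

  -- Block t receives the bit of block t + 1, and the bit of block 0 goes to the last block: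
  -- the factor Q + a Q^(t+1) is Q (1 + a Q^t), and the choice Q of the factor Q + a adds one to v.
  shiftBits : Code → Vec Code n → Vec Code (suc n)
  shiftBits ((b₀ , s) , v) []                     = lastBlock b₀ s v ∷ []
  shiftBits ((b₀ , s) , v) (((β , s') , v') ∷ cs) = ((β , s) , v) ∷ shiftBits ((b₀ , s') , v') cs

  unshiftBits : Vec Code (suc n) → Code × Vec Code n
  unshiftBits {zero}  (c ∷ [])            = unLastBlock c , []
  unshiftBits {suc n} (((β , s) , v) ∷ cs) with unshiftBits cs
  ... | ((b₀ , s') , v') , rest = ((b₀ , s) , v) , ((β , s') , v') ∷ rest

  unshiftBits-shiftBits : ∀ c (cs : Vec Code n) → unshiftBits (shiftBits c cs) ≡ (c , cs)
  unshiftBits-shiftBits ((bit0 , s) , v) []                     = refl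
  unshiftBits-shiftBits ((bit1 , s) , v) []                     = refl
  unshiftBits-shiftBits ((b₀ , s) , v)   (((β , s') , v') ∷ cs)
    rewrite unshiftBits-shiftBits ((b₀ , s') , v') cs = refl

  shiftBits-unshiftBits : ∀ (cs : Vec Code (suc n)) → AtLast FullBlock cs →
                          let (c , rest) = unshiftBits cs in shiftBits c rest ≡ cs
  shiftBits-unshiftBits (((bit1 , s) , v)     ∷ []) _ = refl
  shiftBits-unshiftBits (((bit0 , s) , suc v) ∷ []) _ = refl
  shiftBits-unshiftBits (((bit0 , s) , zero)  ∷ []) ()
  shiftBits-unshiftBits {suc n} (((β , s) , v) ∷ cs) full
    with unshiftBits cs | shiftBits-unshiftBits cs (AtLast-∷⁻ cs full)
  ... | ((b₀ , s') , v') , rest | eq = cong (((β , s) , v) ∷_) eq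

  shiftBits-full : ∀ c (cs : Vec Code n) → AtLast FullBlock (shiftBits c cs)
  shiftBits-full ((bit0 , s) , v) []       = tt
  shiftBits-full ((bit1 , s) , v) []       = tt
  shiftBits-full ((b₀ , s) , v)   (((β , s') , v') ∷ cs) =
    AtLast-∷⁺ (shiftBits ((b₀ , s') , v') cs) (shiftBits-full ((b₀ , s') , v') cs)

  shiftBits-weight : ∀ o b₀ s v (cs : Vec Code n) →
    indexedWeight codeWeight o (shiftBits ((b₀ , s) , v) cs)
    ≡ ((bitWeight₁ 0 b₀ +ᵉ Qᵉ o) +ᵉ (abWeight o s +ᵉ QWeight o v)) +ᵉ indexedWeight codeWeight₁ (suc o) cs
  shiftBits-weight o bit1 s v [] = cong (_+ᵉ 0ᵉ) (+ᵉ-assoc (suc o , o , o , o) (abWeight o s) (QWeight o v))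
  shiftBits-weight o bit0 s v [] =
    cong (_+ᵉ 0ᵉ) (solve 4 (λ Q1 Qo A V → A ⊞ ((Q1 ⊞ Qo) ⊞ V) ⊜ (Q1 ⊞ Qo) ⊞ (A ⊞ V)) refl
                           (Qᵉ 1) (Qᵉ o) (abWeight o s) (QWeight o v))
    where open +ᵉ-Solver using (solve; _⊜_; _⊞_)
  shiftBits-weight o b₀ s v (((β , s') , v') ∷ cs) = begin
    ((Bβ +ᵉ A) +ᵉ V) +ᵉ indexedWeight codeWeight (suc o) (shiftBits ((b₀ , s') , v') cs)
      ≡⟨ cong (((Bβ +ᵉ A) +ᵉ V) +ᵉ_) (shiftBits-weight (suc o) b₀ s' v' cs) ⟩
    ((Bβ +ᵉ A) +ᵉ V) +ᵉ (((B₀ +ᵉ (Qᵉ 1 +ᵉ Qᵉ o)) +ᵉ (A' +ᵉ V')) +ᵉ R)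
      ≡⟨ solve 9 (λ Bβ A V B₀ Q1 Qo A' V' R →
                    ((Bβ ⊞ A) ⊞ V) ⊞ (((B₀ ⊞ (Q1 ⊞ Qo)) ⊞ (A' ⊞ V')) ⊞ R)
                    ⊜ ((B₀ ⊞ Qo) ⊞ (A ⊞ V)) ⊞ ((((Q1 ⊞ Bβ) ⊞ A') ⊞ V') ⊞ R))
               refl Bβ A V B₀ (Qᵉ 1) (Qᵉ o) A' V' R ⟩
    ((B₀ +ᵉ Qᵉ o) +ᵉ (A +ᵉ V)) +ᵉ ((((Qᵉ 1 +ᵉ Bβ) +ᵉ A') +ᵉ V') +ᵉ R)
      ≡⟨ cong (λ B → ((B₀ +ᵉ Qᵉ o) +ᵉ (A +ᵉ V)) +ᵉ (((B +ᵉ A') +ᵉ V') +ᵉ R)) (sym (bitWeight₁-suc o β)) ⟩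
    ((B₀ +ᵉ Qᵉ o) +ᵉ (A +ᵉ V)) +ᵉ (codeWeight₁ (suc o) ((β , s') , v') +ᵉ R)
      ∎
    where
    open ≡-Reasoning
    open +ᵉ-Solver using (solve; _⊜_; _⊞_)
    Bβ = bitWeight o β
    A  = abWeight o s
    V  = QWeight o v
    B₀ = bitWeight₁ 0 b₀
    A' = abWeight (suc o) s'
    V' = QWeight (suc o) v'
    R  = indexedWeight codeWeight₁ (suc (suc o)) cs

  rotateBits : Vec Code n → Vec Code n
  rotateBits []       = []
  rotateBits (c ∷ cs) = shiftBits c cs

  rotateBits-weight : ∀ (cs : Vec Code n) → indexedWeight codeWeight 0 (rotateBits cs) ≡ indexedWeight codeWeight₁ 0 cs
  rotateBits-weight []                      = refl
  rotateBits-weight (((b₀ , s) , v) ∷ cs) =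
    trans (shiftBits-weight 0 b₀ s v cs)
          (cong (_+ᵉ indexedWeight codeWeight₁ 1 cs)
                (trans (cong (_+ᵉ (abWeight 0 s +ᵉ QWeight 0 v)) (+ᵉ-identityʳ (bitWeight₁ 0 b₀)))
                       (sym (+ᵉ-assoc (bitWeight₁ 0 b₀) (abWeight 0 s) (QWeight 0 v)))))

  term1-codes : ∀ n → Generates (term1 n) (AtLast FullBlock) (indexedWeight codeWeight 0)
  term1-codes n = Generates-bijection rotation
    (⊛-zip-generates (⊛-zip-generates (prodS-generates bits₁-generates n) (prodS-generates ab-generates n))
                     (prodS-generates Q-generates n))
    where
    rotation : WeightedBijection (λ (_ : Vec Code n) → ⊤) (indexedWeight codeWeight₁ 0)
                                 (AtLast FullBlock) (indexedWeight codeWeight 0)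
    rotation = record
      { to         = rotateBits
      ; injective  = injective
      ; to-∈       = λ { {[]} _ → tt ; {c ∷ cs} _ → shiftBits-full c cs }
      ; weight     = λ {cs} _ → rotateBits-weight cs
      ; surjective = surjective
      }
      where
      injective : ∀ {cs cs' : Vec Code n} → ⊤ → ⊤ → rotateBits cs ≡ rotateBits cs' → cs ≡ cs'
      injective {[]}     {[]}       _ _ _  = refl
      injective {c ∷ cs} {c' ∷ cs'} _ _ eq =
        cong (λ (c , cs) → c ∷ cs)
             (trans (sym (unshiftBits-shiftBits c cs)) (trans (cong unshiftBits eq) (unshiftBits-shiftBits c' cs')))
      surjective : ∀ {cs : Vec Code n} → AtLast FullBlock cs → ∃[ cs' ] (⊤ × cs ≡ rotateBits cs')
      surjective {[]}          _    = [] , tt , refl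
      surjective {cs@(_ ∷ _)} full =
        let (c , rest) = unshiftBits cs in c ∷ rest , tt , sym (shiftBits-unshiftBits cs full)

  term1-generates : ∀ n → Generates (term1 n) (λ λs → InP1 λs × effectiveLength λs ≡ n + n) weightExp
  term1-generates n = Generates-bijection
    (decode-bijection (λ {cs} full → effectiveLength-decode-full cs full)
                      (λ {λs} inP1 eq → ℕ.≤-trans (length≤effectiveLength λs) (ℕ.≤-reflexive eq)
                                      , encode-full n inP1 eq))
    (term1-codes n)

  Enumeration⇒Converges : ∀ {P : List ℕ → Set} {s N₀} → (∀ N → N₀ ≤ N → Enumeration P (s N)) → Converges s (s N₀)
  Enumeration⇒Converges {N₀ = N₀} e = N₀ , λ N N₀≤N → Enumeration-size-unique (e N N₀≤N) (e N₀ ℕ.≤-refl)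

  length≤a+c : ∀ {λs} → Positive λs → length λs ≤ expA (weightExp λs) + expC (weightExp λs)
  length≤a+c {[]}            _                 = z≤n
  length≤a+c {zero ∷ _}      (() ∷ _)
  length≤a+c {suc x ∷ []}    _                 = s≤s z≤n
  length≤a+c {suc x ∷ zero ∷ _} (_ ∷ () ∷ _)
  length≤a+c {suc x ∷ suc y ∷ r} (_ ∷ _ ∷ pos) = begin
    suc (suc (length r))                           ≤⟨ s≤s (s≤s (length≤a+c pos)) ⟩
    suc (suc (A + C))                              ≡⟨ cong suc (sym (ℕ.+-suc A C)) ⟩
    suc A + suc C                                  ≤⟨ ℕ.+-mono-≤ (s≤s (ℕ.m≤n+m A ⌊ x /2⌋)) (s≤s (ℕ.m≤n+m C ⌊ y /2⌋)) ⟩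
    suc (⌊ x /2⌋ + A) + suc (⌊ y /2⌋ + C)          ∎
    where
    open ℕ.≤-Reasoning
    A = expA (weightExp r)
    C = expC (weightExp r)

  P1At : Exp → List ℕ → Set
  P1At E λs = InP1 λs × weightExp λs ≡ E

  P1At-length : ∀ {E λs} → P1At E λs → length λs ≤ expA E + expC E
  P1At-length {λs = λs} (((_ , pos) , _) , refl) = length≤a+c pos

  rhsPartial-stable : ∀ i j k l N → suc (suc (i + k)) ≤ N → Enumeration (P1At (i , j , k , l)) (rhsPartial N i j k l)
  rhsPartial-stable i j k l N 2+i+k≤N =
    Enumeration-⇔ (λ _ → mk⇔ (λ ((inP1 , _) , w≡) → inP1 , w≡) lengthBounded) (rhsPartial-generates N i j k l)
    where
    lengthBounded : ∀ {λs} → P1At (i , j , k , l) λs → (InP1 λs × length λs ≤ N + N) × weightExp λs ≡ (i , j , k , l)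
    lengthBounded p =
      (proj₁ p , ℕ.≤-trans (P1At-length p) (ℕ.≤-trans (ℕ.m≤n+m (i + k) 2) (ℕ.≤-trans 2+i+k≤N (ℕ.m≤m+n N N))))
      , proj₂ p

  sumS-stable : ∀ {f : ℕ → FPS} (shape : ℕ → ℕ) →
    (∀ n → Generates (f n) (λ λs → InP1 λs × effectiveLength λs ≡ shape n) weightExp) →
    (∀ {n n'} → shape n ≡ shape n' → n ≡ n') → (∀ n → n ≤ shape n) →
    ∀ i j k l N → suc (suc (i + k)) ≤ N →
    Enumeration (λ λs → P1At (i , j , k , l) λs × ∃[ n ] (effectiveLength λs ≡ shape n)) (sumS N f i j k l)
  sumS-stable shape gf shape-injective n≤shape i j k l N 2+i+k≤N =
    Enumeration-⇔ (λ _ → mk⇔ forgetBound addBound) (sumS-generates gf disjoint N i j k l)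
    where
    E = i , j , k , l
    forgetBound : ∀ {λs} → (∃[ n ] (n < N × InP1 λs × effectiveLength λs ≡ shape n)) × weightExp λs ≡ E →
                  P1At E λs × ∃[ n ] (effectiveLength λs ≡ shape n)
    forgetBound ((n , _ , inP1 , e) , w≡) = (inP1 , w≡) , n , e
    n<N : ∀ {λs} → P1At (i , j , k , l) λs → ∀ n → effectiveLength λs ≡ shape n → n < N
    n<N {λs} p n e = ℕ.≤-trans (s≤s (begin
      n                           ≤⟨ n≤shape n ⟩
      shape n                     ≡⟨ sym e ⟩
      effectiveLength λs          ≤⟨ effectiveLength≤1+length λs ⟩
      suc (length λs)             ≤⟨ s≤s (P1At-length p) ⟩
      suc (i + k)                 ∎)) 2+i+k≤N
      where open ℕ.≤-Reasoning
    addBound : ∀ {λs} → P1At E λs × ∃[ n ] (effectiveLength λs ≡ shape n) →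
               (∃[ n ] (n < N × InP1 λs × effectiveLength λs ≡ shape n)) × weightExp λs ≡ E
    addBound (p , n , e) = (n , n<N p n e , proj₁ p , e) , proj₂ p
    disjoint : DisjointFamily (λ n λs → InP1 λs × effectiveLength λs ≡ shape n)
    disjoint (_ , e) (_ , e') = shape-injective (trans (sym e) e')

  P1At-even⊎odd : ∀ {E v₁ v₂} →
    Enumeration (λ λs → P1At E λs × ∃[ n ] (effectiveLength λs ≡ n + n)) v₁ →
    Enumeration (λ λs → P1At E λs × ∃[ n ] (effectiveLength λs ≡ suc (n + n))) v₂ →
    Enumeration (P1At E) (v₁ ℤ.+ v₂)
  P1At-even⊎odd evens odds =
    Enumeration-⇔ (λ λs → mk⇔ [ proj₁ , proj₁ ] (λ p → Sum.map (p ,_) (p ,_) (even⊎odd (effectiveLength λs))))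
      (Enumeration-∪ (λ { _ (_ , n , e) (_ , n' , e') → even≢odd n n' (trans (sym e) e') }) evens odds)

  term1-sum-stable : ∀ i j k l N → suc (suc (i + k)) ≤ N →
    Enumeration (λ λs → P1At (i , j , k , l) λs × ∃[ n ] (effectiveLength λs ≡ n + n)) (sumS N term1 i j k l)
  term1-sum-stable = sumS-stable (λ n → n + n) term1-generates double-injective (λ n → ℕ.m≤m+n n n)

  term2-sum-stable : ∀ i j k l N → suc (suc (i + k)) ≤ N →
    Enumeration (λ λs → P1At (i , j , k , l) λs × ∃[ n ] (effectiveLength λs ≡ suc (n + n))) (sumS N term2 i j k l)
  term2-sum-stable = sumS-stable (λ n → suc (n + n)) term2-generates (double-injective ∘ ℕ.suc-injective)
                                 (λ n → ℕ.≤-trans (ℕ.m≤m+n n n) (ℕ.n≤1+n (n + n)))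

open import Defs
open import Data.Nat using (ℕ)
open import Data.Integer using (ℤ; +_; _+_)
open import Data.Product using (_×_; _,_; ∃-syntax)
open import Data.List using (List; length)
open import Data.List.Membership.Propositional using (_∈_)
open import Data.List.Relation.Unary.Unique.Propositional using (Unique)
open import Function.Bundles using (_⇔_)
open import Relation.Binary.PropositionalEquality using (_≡_)
import Data.Nat as ℕ
import Data.Nat.Properties as ℕ
open Counting
open Enumeration

mainTheorem3 : (i j k l : ℕ) → ∃[ v ]
    ((∃[ L ] (Unique L
    × (∀ (λs : List ℕ) → (λs ∈ L) ⇔ (InP1 λs × weightExp λs ≡ (i , j , k , l)))
    × + (length L) ≡ v))
    × (∃[ v₁ ] ∃[ v₂ ] (Converges (λ N → sumS N term1 i j k l) v₁
    × Converges (λ N → sumS N term2 i j k l) v₂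
    × v₁ + v₂ ≡ v))
    × Converges (λ N → rhsPartial N i j k l) v)
mainTheorem3 i j k l =
  rhsPartial N₀ i j k l ,
  (elements 𝒫₁ , unique 𝒫₁ , ∈⇔ 𝒫₁ , size 𝒫₁) ,
  (sumS N₀ term1 i j k l , sumS N₀ term2 i j k l ,
   Enumeration⇒Converges (term1-sum-stable i j k l) ,
   Enumeration⇒Converges (term2-sum-stable i j k l) ,
   Enumeration-size-unique (P1At-even⊎odd (term1-sum-stable i j k l N₀ ℕ.≤-refl)
                                          (term2-sum-stable i j k l N₀ ℕ.≤-refl)) 𝒫₁) ,
  Enumeration⇒Converges (rhsPartial-stable i j k l)
  where
  N₀ = ℕ.suc (ℕ.suc (i ℕ.+ k))
  𝒫₁ = rhsPartial-stable i j k l N₀ ℕ.≤-refl
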